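{- Let $N_1=(G_1=(V_1,E_1),\mathcal{S}_1,\mathcal{T}_1,f_1)$ and $N_2=(G_2=(V_2,E_2),\mathcal{S}_2,\mathcal{T}_2,f_2)$ be node-capacitated multicommodity instances with $n_1=|V_1|$, $n_2=|V_2|$, and let $C_1=(\mathbb{F},r_1,\pi_1,L_1)$ and $C_2=(\mathbb{F},r_2,\pi_2,L_2)$ be linear network codes for $N_1$ and $N_2$ respectively, over the same finite field $\mathbb{F}$. Then there is a linear network code $C$ for the strong product $N_1\boxtimes N_2$ whose coding matrix is $\left[I_{n_1}\otimes L_2,\ L_1\otimes I_{n_2}\right]$, such that: (1) if $C_1$ and $C_2$ are decodable with rates $p_1$ and $p_2$ respectively, then $C$ is decodable with rate $p:=n_1p_2+n_2p_1-p_1|f_2(\mathcal{T}_2)|$; (2) if $C_1$ and $C_2$ are $\rho_1$-certifiable and $\rho_2$-certifiable respectively, then $C$ is $\rho$-certifiable for $N_1\boxtimes N_2$, where $\rho:=n_1\rho_2+n_2\rho_1-\rho_1|f_2(\mathcal{S}_2)|$.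
   Context: A node-capacitated multicommodity instance is a tuple $N=(G,\mathcal{S},\mathcal{T},f)$ where $G=(V,E)$ is a finite undirected graph, $\mathcal{S}=(s_1,\dots,s_k)$ and $\mathcal{T}=(t_1,\dots,t_k)$ are ordered lists of sources and sinks (objects not in $V$), $s_i$ being paired with $t_i$, and $f:\mathcal{S}\cup\mathcal{T}\to 2^V$. The associated network is obtained from $G$ (whose edges may be traversed in either direction) by adding a node for each source and sink and directed edges $(s,v)$ for $v\in f(s)$ and $(u,t)$ for $u\in f(t)$. For a set $A'$ of sources or sinks, $f(A')=\bigcup_{a\in A'}f(a)$; for $v\in V$, $f^{ -1}(v)$ is the set of sources $s$ with $v\in f(s)$. Strong product: $N_1\boxtimes N_2=(G_1\boxtimes G_2,\mathcal{S}_1\cup\mathcal{S}_2,\mathcal{T}_1\cup\mathcal{T}_2,f)$ where $G_1\boxtimes G_2$ has vertex set $V_1\times V_2$ and $(u,v),(u',v')$ are adjacent iff $(u,v)\neq(u',v')$, ($u=u'$ or $uu'\in E_1$) and ($v=v'$ or $vv'\in E_2$); $f(s)=f_1(s)\times V_2$ for $s\in\mathcal{S}_1$, $f(s)=V_1\times f_2(s)$ for $s\in\mathcal{S}_2$, and likewise for sinks; the source lists are treated as disjoint, pairing preserved. Support: for a vector $x$ with entries indexed by a set $A$, $\mathsf{supp}(x)=\{a\in A: x[a]\neq 0\}$. Linear network code $(\mathbb{F},r,\pi,L)$ of an instance $((V,E),\mathcal{S},\mathcal{T},f)$ with $n=|V|$: a finite field $\mathbb{F}$, a function $r:\mathcal{S}\to\mathbb{N}$,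 a bijection $\pi:V\to\{1,\dots,n\}$, and an $n\times r(\mathcal{S})$ matrix $L$ over $\mathbb{F}$ whose rows are indexed by $V$ and whose columns are indexed by the messages $\mathcal{M}=\bigcup_{s}\mathcal{M}(s)$, $\mathcal{M}(s)=\{(s,1),\dots,(s,r(s))\}$, $r(\mathcal{S})=\sum_s r(s)$. With $N(v)=\{v\}\cup\{u\in V:\pi(u)<\pi(v),\ uv\in E\}$, it is required that for every $v\in V$ there is $a_v\in\mathbb{F}^{1\times n}$ with $\{v\}\subseteq\mathsf{supp}(a_v)\subseteq N(v)$ and $\mathsf{supp}(a_vL)\subseteq\mathcal{M}(f^{ -1}(v))=\bigcup_{s\in f^{ -1}(v)}\mathcal{M}(s)$. Decodable with rate $p$: there is $D\subseteq\mathcal{M}$ with $|\mathcal{M}|-|D|=p$ such that for every message $m=(s_i,j)\in\mathcal{M}\setminus D$ there is $d_m\in\mathbb{F}^{1\times n}$ with $\mathsf{supp}(d_m)\subseteq f(t_i)$ and $\{m\}\subseteq\mathsf{supp}(d_mL)\subseteq\{m\}\cup D$. Multicut: a set $M\subseteq V$ such that deleting the vertices of $M$ from the network disconnects every $s_i$ from $t_i$. For $A\subseteq V$, $I_A$ is the $n\times|A|$ matrix with $I_A[v,w]=1$ if $v=w$ and $0$ otherwise. $\rho$-certifiable: (1) there are cliques $K(v)\subseteq N(v)$ of $G$, $v\in V$, such that the code still satisfies all requirements of a linear network code when $N(v)$ is replaced by $K(v)$ for every $v$; (2) every multicut $M$ satisfies $\mathsf{rank}(L^TI_M)\ge\rho$.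 $\otimes$ is the Kronecker product, $I_n$ the $n\times n$ identity; rows of the product matrix are indexed by $V_1\times V_2$, columns of $I_{n_1}\otimes L_2$ by $V_1\times\mathcal{M}_2$ and of $L_1\otimes I_{n_2}$ by $\mathcal{M}_1\times V_2$ (so the product code has $r(s)=r_1(s)n_2$ for $s\in\mathcal{S}_1$ and $r(s)=r_2(s)n_1$ for $s\in\mathcal{S}_2$). -}

module Defs where

open import Data.Nat using (ℕ; zero; suc; _+_; _*_; _∸_)
open import Data.Fin using (Fin; zero; suc; splitAt; remQuot; _<_)
open import Data.Fin.Properties using (*↔×) renaming (_≟_ to _≟F_)
open import Data.Bool using (Bool; true; false; if_then_else_; _∧_; _∨_; not)
open import Data.Sum using (_⊎_; inj₁; inj₂; [_,_]′)
open import Data.Product using (Σ; Σ-syntax; ∃; _×_; _,_; proj₁; proj₂)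
open import Data.Product.Function.NonDependent.Propositional using (_×-↔_)
open import Function.Bundles using (_↔_; Inverse)
open import Function.Construct.Composition using (_↔-∘_)
open import Relation.Nullary using (¬_; does; yes; no)
open import Relation.Nullary.Decidable using (dec-true)
open import Data.Empty using (⊥-elim)
open import Relation.Binary.PropositionalEquality using (_≡_; _≢_; refl; sym)
open import Algebra.Core using (Op₁; Op₂)
open import Algebra.Structures using (IsCommutativeRing)

record FiniteField : Set₁ where
  field
    Carrier           : Set
    _+F_ _*F_         : Op₂ Carrier
    -F_               : Op₁ Carrier
    0# 1#             : Carrier
    isCommutativeRing : IsCommutativeRing _≡_ _+F_ _*F_ -F_ 0# 1#
    0≢1               : 0# ≢ 1#
    inverse           : ∀ x → x ≢ 0# → ∃ λ y → x *F y ≡ 1#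
    size              : ℕ
    enumeration       : Fin size ↔ Carrier

sumℕ : ∀ n → (Fin n → ℕ) → ℕ
sumℕ zero    g = 0
sumℕ (suc n) g = g zero + sumℕ n (λ i → g (suc i))

anyFin : ∀ n → (Fin n → Bool) → Bool
anyFin zero    g = false
anyFin (suc n) g = g zero ∨ anyFin n (λ i → g (suc i))

-- Vertex set V with |V| = n (witnessed by an enumeration Fin n ↔ V),
-- simple undirected graph given by a symmetric irreflexive Bool relation,
-- k commodities: source s_i and sink t_i indexed by i : Fin k,
-- fS i = f(s_i), fT i = f(t_i) as Bool-valued subsets of V.

record Instance : Set₁ where
  field
    V          : Set
    n          : ℕ
    vertices   : Fin n ↔ V
    adj        : V → V → Bool
    adj-sym    : ∀ u v → adj u v ≡ adj v u
    adj-irrefl : ∀ v → adj v v ≡ false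
    k          : ℕ
    fS fT      : Fin k → V → Bool

  eqV : V → V → Bool
  eqV u v = does (Inverse.from vertices u ≟F Inverse.from vertices v)

  eqV-refl : ∀ v → eqV v v ≡ true
  eqV-refl v = dec-true (Inverse.from vertices v ≟F Inverse.from vertices v) refl

  eqV-sym : ∀ u v → eqV u v ≡ eqV v u
  eqV-sym u v with Inverse.from vertices u ≟F Inverse.from vertices v
                 | Inverse.from vertices v ≟F Inverse.from vertices u
  ... | yes p | yes q = refl
  ... | no p  | no q  = refl
  ... | yes p | no q  = ⊥-elim (q (sym p))
  ... | no p  | yes q = ⊥-elim (p (sym q))

  card : (V → Bool) → ℕ
  card A = sumℕ n (λ i → if A (Inverse.to vertices i) then 1 else 0)

  fSall fTall : V → Bool
  fSall v = anyFin k (λ i → fS i v)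
  fTall v = anyFin k (λ i → fT i v)

  data PathAvoid (M : V → Bool) : V → V → Set where
    here : ∀ {v} → M v ≡ false → PathAvoid M v v
    step : ∀ {u v w} → M u ≡ false → adj u v ≡ true → PathAvoid M v w → PathAvoid M u w

  -- s_i is connected to t_i in the network after deleting M
  -- (paths cannot pass through other sources/sinks: sources have only
  --  outgoing edges and sinks only incoming ones)
  Connected : (M : V → Bool) → Fin k → Set
  Connected M i = Σ[ u ∈ V ] Σ[ w ∈ V ] (fS i u ≡ true × fT i w ≡ true × PathAvoid M u w)

  Multicut : (V → Bool) → Set
  Multicut M = ∀ i → ¬ Connected M i

  Nbh : (V ↔ Fin n) → V → V → Set
  Nbh π v u = (u ≡ v) ⊎ ((Inverse.to π u < Inverse.to π v) × adj u v ≡ true)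

  IsClique : (V → Set) → Set
  IsClique K = ∀ u w → K u → K w → u ≢ w → adj u w ≡ true

module LinAlg (F : FiniteField) where
  open FiniteField F

  sumF : ∀ m → (Fin m → Carrier) → Carrier
  sumF zero    g = 0#
  sumF (suc m) g = g zero +F sumF m (λ i → g (suc i))

  SuppSub : {A : Set} → (A → Carrier) → (A → Set) → Set
  SuppSub x S = ∀ a → x a ≢ 0# → S a

  InSupp : {A : Set} → (A → Carrier) → A → Set
  InSupp x a = x a ≢ 0#

  RankAtLeast : {R C : Set} → (R → C → Carrier) → ℕ → Set
  RankAtLeast {R} {C} X ρ =
    Σ[ col ∈ (Fin ρ → C) ]
      (∀ (c : Fin ρ → Carrier) →
        (∀ row → sumF ρ (λ t → c t *F X row (col t)) ≡ 0#) →
        ∀ t → c t ≡ 0#)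

  kron : {R₁ C₁ R₂ C₂ : Set} → (R₁ → C₁ → Carrier) → (R₂ → C₂ → Carrier) →
         (R₁ × R₂) → (C₁ × C₂) → Carrier
  kron A B (r₁ , r₂) (c₁ , c₂) = A r₁ c₁ *F B r₂ c₂

module Codes (F : FiniteField) (N : Instance) where
  open FiniteField F
  open Instance N
  open LinAlg F

  Msg : (Fin k → ℕ) → Set
  Msg r = Σ[ i ∈ Fin k ] Fin (r i)

  record Code : Set where
    constructor mkCode
    field
      r : Fin k → ℕ
      π : V ↔ Fin n
      L : V → Msg r → Carrier

  module _ (C : Code) where
    open Code C

    sumV : (V → Carrier) → Carrier
    sumV g = sumF n (λ i → g (Inverse.to vertices i))

    _·L : (V → Carrier) → Msg r → Carrier
    (a ·L) m = sumV (λ u → a u *F L u m)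

    MsgAt : V → Msg r → Set
    MsgAt v m = fS (proj₁ m) v ≡ true

    CodingCondition : (V → V → Set) → Set
    CodingCondition K = ∀ v → Σ[ a ∈ (V → Carrier) ]
      (InSupp a v × SuppSub a (K v) × SuppSub (a ·L) (MsgAt v))

    IsLinearNetworkCode : Set
    IsLinearNetworkCode = CodingCondition (Nbh π)

    numMsgs : ℕ
    numMsgs = sumℕ k r

    cardMsgs : (Msg r → Bool) → ℕ
    cardMsgs D = sumℕ k (λ i → sumℕ (r i) (λ j → if D (i , j) then 1 else 0))

    Decodable : ℕ → Set
    Decodable p = Σ[ D ∈ (Msg r → Bool) ]
      (cardMsgs D + p ≡ numMsgs ×
       (∀ (m : Msg r) → D m ≡ false →
          Σ[ d ∈ (V → Carrier) ]
            (SuppSub d (λ u → fT (proj₁ m) u ≡ true) ×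
             InSupp (d ·L) m ×
             SuppSub (d ·L) (λ m' → (m' ≡ m) ⊎ (D m' ≡ true)))))

    I[_] : (M : V → Bool) → V → (Σ[ w ∈ V ] M w ≡ true) → Carrier
    I[ M ] v (w , _) = if eqV v w then 1# else 0#

    LᵀI : (M : V → Bool) → Msg r → (Σ[ w ∈ V ] M w ≡ true) → Carrier
    LᵀI M m c = sumV (λ v → L v m *F I[ M ] v c)

    Certifiable : ℕ → Set
    Certifiable ρ =
      (Σ[ K ∈ (V → V → Bool) ]
        ((∀ v → IsClique (λ u → K v u ≡ true)) ×
         (∀ v u → K v u ≡ true → Nbh π v u) ×
         CodingCondition (λ v u → K v u ≡ true))) ×
      (∀ (M : V → Bool) → Multicut M → RankAtLeast (LᵀI M) ρ)

_⊠_ : Instance → Instance → Instance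
N₁ ⊠ N₂ = record
  { V          = V₁ × V₂
  ; n          = n₁ * n₂
  ; vertices   = (vertices₁ ×-↔ vertices₂) ↔-∘ *↔×
  ; adj        = padj
  ; adj-sym    = padj-sym
  ; adj-irrefl = padj-irrefl
  ; k          = k₁ + k₂
  ; fS         = λ i p → [ (λ i₁ → fS₁ i₁ (proj₁ p)) , (λ i₂ → fS₂ i₂ (proj₂ p)) ]′ (splitAt k₁ i)
  ; fT         = λ i p → [ (λ i₁ → fT₁ i₁ (proj₁ p)) , (λ i₂ → fT₂ i₂ (proj₂ p)) ]′ (splitAt k₁ i)
  }
  where
  open Instance N₁ renaming (V to V₁; n to n₁; vertices to vertices₁; adj to adj₁;
    adj-sym to adj-sym₁; adj-irrefl to adj-irrefl₁; k to k₁; fS to fS₁; fT to fT₁; eqV to eq₁; eqV-sym to eq-sym₁; eqV-refl to eq-refl₁)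
  open Instance N₂ renaming (V to V₂; n to n₂; vertices to vertices₂; adj to adj₂;
    adj-sym to adj-sym₂; adj-irrefl to adj-irrefl₂; k to k₂; fS to fS₂; fT to fT₂; eqV to eq₂; eqV-sym to eq-sym₂; eqV-refl to eq-refl₂)
  padj : V₁ × V₂ → V₁ × V₂ → Bool
  padj (u , v) (u' , v') =
    not (eq₁ u u' ∧ eq₂ v v') ∧ ((eq₁ u u' ∨ adj₁ u u') ∧ (eq₂ v v' ∨ adj₂ v v'))
  padj-sym : ∀ p q → padj p q ≡ padj q p
  padj-sym (u , v) (u' , v')
    rewrite eq-sym₁ u u' | eq-sym₂ v v' | adj-sym₁ u u' | adj-sym₂ v v' = refl
  padj-irrefl : ∀ p → padj p p ≡ false
  padj-irrefl (u , v) rewrite eq-refl₁ u | eq-refl₂ v = refl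

-- For a source s of N₁ (index inj₁ i₁), message number j : Fin (r₁ i₁ * n₂)
-- of s is identified with the column ((s , j₁) , w) of L₁ ⊗ I_{n₂}, where
-- (j₁ , w') = remQuot {r₁ i₁} n₂ j and w is the w'-th vertex of V₂ (i.e. j = j₁·n₂ + w').
-- For a source of N₂ (index inj₂ i₂), message j : Fin (r₂ i₂ * n₁) is the
-- column (w , (s , j₂)) of I_{n₁} ⊗ L₂ with (j₂ , w') = remQuot {r₂ i₂} n₁ j.

module ProductCode (F : FiniteField) (N₁ N₂ : Instance)
                   (C₁ : Codes.Code F N₁) (C₂ : Codes.Code F N₂) where
  open FiniteField F
  open LinAlg F
  open Instance N₁ renaming (V to V₁; n to n₁; vertices to vertices₁; k to k₁; eqV to eq₁)
  open Instance N₂ renaming (V to V₂; n to n₂; vertices to vertices₂; k to k₂; eqV to eq₂)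
  open Codes.Code {F} {N₁} C₁ renaming (r to r₁; L to L₁)
  open Codes.Code {F} {N₂} C₂ renaming (r to r₂; L to L₂)

  Id₁ : V₁ → V₁ → Carrier
  Id₁ u w = if eq₁ u w then 1# else 0#

  Id₂ : V₂ → V₂ → Carrier
  Id₂ v w = if eq₂ v w then 1# else 0#

  I⊗L₂ : V₁ × V₂ → V₁ × Codes.Msg F N₂ r₂ → Carrier
  I⊗L₂ = kron Id₁ L₂

  L₁⊗I : V₁ × V₂ → Codes.Msg F N₁ r₁ × V₂ → Carrier
  L₁⊗I = kron L₁ Id₂

  rSplit : Fin k₁ ⊎ Fin k₂ → ℕ
  rSplit (inj₁ i₁) = r₁ i₁ * n₂
  rSplit (inj₂ i₂) = r₂ i₂ * n₁

  entry : (x : Fin k₁ ⊎ Fin k₂) → Fin (rSplit x) → V₁ × V₂ → Carrier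
  entry (inj₁ i₁) j p =
    L₁⊗I p ((i₁ , proj₁ (remQuot {r₁ i₁} n₂ j)) , Inverse.to vertices₂ (proj₂ (remQuot {r₁ i₁} n₂ j)))
  entry (inj₂ i₂) j p =
    I⊗L₂ p (Inverse.to vertices₁ (proj₂ (remQuot {r₂ i₂} n₁ j)) , (i₂ , proj₁ (remQuot {r₂ i₂} n₁ j)))

  prodR : Fin (k₁ + k₂) → ℕ
  prodR i = rSplit (splitAt k₁ i)

  prodL : V₁ × V₂ → Codes.Msg F (N₁ ⊠ N₂) prodR → Carrier
  prodL p (i , j) = entry (splitAt k₁ i) j p

  prodCode : (Instance.V (N₁ ⊠ N₂) ↔ Fin (Instance.n (N₁ ⊠ N₂))) → Codes.Code F (N₁ ⊠ N₂)
  prodCode π = Codes.mkCode prodR π prodL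

-- The product code is built from Kronecker products: the local coding vector of (u , v) is aᵤ ⊗ aᵥ, and a
-- row vector x₁ ⊗ x₂ meets the column (m , v) of L₁ ⊗ I in (x₁L₁)[m]·x₂[v] and the column (u , m) of I ⊗ L₂
-- in x₁[u]·(x₂L₂)[m].  Decoding: (u , m) of N₂ is decoded by eᵤ ⊗ dₘ, and (m , v) of N₁ by dₘ ⊗ x, where x is
-- row v of L₂ minus multiples of the N₂-decoders cancelling every undecoded message; this requires v ∉ f₂(T₂),
-- so the messages (m , v) with v ∈ f₂(T₂) are given up, costing p₁·|f₂(T₂)|.  Rank: a multicut M of the product
-- meets every slice {u} × V₂ in a multicut of N₂, giving n₁ρ₂ independent rows, and for each v ∉ f₂(S₂) the
-- set of x with {x} × K(v) ⊆ M is a multicut of N₁ (K(v) is a clique), giving ρ₁ rows whose combinations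
-- with the coding vector of v vanish on the columns of I ⊗ L₂.  These vectors are independent because the
-- coding vectors are triangular with respect to π₂, and a Steinitz exchange turns independent vectors in the
-- span of the rows of M into rank(Lᵀ I_M).

module Submission where

open import Defs

open import Algebra.Bundles using (CommutativeRing; CommutativeSemiring)
open import Algebra.Core using (Op₂)
import Algebra.Properties.CommutativeSemigroup as CommutativeSemigroupProperties
import Algebra.Properties.Ring as RingProperties
open import Algebra.Structures using (IsCommutativeSemiring)
open import Data.Bool as Bool using (Bool; true; false; if_then_else_; _∧_; _∨_; not)
open import Data.Bool.Properties using (∨-zeroʳ; ∨-conicalˡ; ∨-conicalʳ; ∧-conicalˡ; ∧-conicalʳ)
open import Data.Empty using (⊥-elim)
open import Data.Fin as Fin using (Fin; zero; suc; _↑ˡ_; _↑ʳ_; splitAt; remQuot; combine; punchIn; toℕ)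
import Data.Fin.Induction as FinInd
open import Data.Fin.Properties as FinP using (splitAt-↑ˡ; splitAt-↑ʳ; punchInᵢ≢i)
open import Data.Nat as ℕ using (ℕ)
import Data.Nat.Properties as ℕP
open import Data.Product using (Σ; Σ-syntax; ∃; ∃₂; ∃-syntax; _×_; _,_; proj₁; proj₂; uncurry; map₁)
open import Data.Product.Function.NonDependent.Propositional using (_×-↔_)
open import Data.Sum using (_⊎_; inj₁; inj₂; [_,_]′)
import Data.Vec.Functional as Vec
open import Data.Vec.Functional.Properties using (insertAt-lookup; insertAt-punchIn)
open import Function using (_∘_; case_of_)
open import Function.Bundles using (Inverse; Injection; _↔_)
open import Function.Construct.Composition using (_↔-∘_)
open import Function.Properties.Inverse using (↔-sym; Inverse⇒Injection)
open import Induction.WellFounded using (module All)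
open import Level using (0ℓ)
import Relation.Binary.Construct.On as On
open import Relation.Binary.PropositionalEquality
open import Relation.Binary.PropositionalEquality.Properties using (subst-sym-subst)
open import Relation.Nullary using (¬_; Dec; yes; no; does; ¬?; _×-dec_; _→-dec_)
open import Relation.Nullary.Decidable using (map′; decidable-stable)

dec-true⁻¹ : ∀ {a} {A : Set a} (a? : Dec A) → does a? ≡ true → A
dec-true⁻¹ (yes a) _ = a

dec-false⁻¹ : ∀ {a} {A : Set a} (a? : Dec A) → does a? ≡ false → ¬ A
dec-false⁻¹ (no ¬a) _ = ¬a

from-injective : ∀ {a b} {A : Set a} {B : Set b} (e : A ↔ B) {x y : B} →
  Inverse.from e x ≡ Inverse.from e y → x ≡ y
from-injective e = Injection.injective (Inverse⇒Injection (↔-sym e))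

module BlockIndex {a p b q : ℕ} where

  ι₁ : Fin a → Fin p → Fin (a ℕ.* p ℕ.+ b ℕ.* q)
  ι₁ x t = combine x t ↑ˡ b ℕ.* q

  ι₂ : Fin b → Fin q → Fin (a ℕ.* p ℕ.+ b ℕ.* q)
  ι₂ y t = a ℕ.* p ↑ʳ combine y t

  infixr 5 _⊕_
  _⊕_ : ∀ {ℓ} {X : Set ℓ} → (Fin a → Fin p → X) → (Fin b → Fin q → X) → Fin (a ℕ.* p ℕ.+ b ℕ.* q) → X
  (f ⊕ g) i = [ uncurry f ∘ remQuot {a} p , uncurry g ∘ remQuot {b} q ]′ (splitAt (a ℕ.* p) i)

  ⊕-ι₁ : ∀ {ℓ} {X : Set ℓ} (f : Fin a → Fin p → X) (g : Fin b → Fin q → X) x t → (f ⊕ g) (ι₁ x t) ≡ f x t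
  ⊕-ι₁ f g x t rewrite splitAt-↑ˡ (a ℕ.* p) (combine x t) (b ℕ.* q) = cong (uncurry f) (FinP.remQuot-combine x t)

  ⊕-ι₂ : ∀ {ℓ} {X : Set ℓ} (f : Fin a → Fin p → X) (g : Fin b → Fin q → X) y t → (f ⊕ g) (ι₂ y t) ≡ g y t
  ⊕-ι₂ f g y t rewrite splitAt-↑ʳ (a ℕ.* p) (b ℕ.* q) (combine y t) = cong (uncurry g) (FinP.remQuot-combine y t)

  ι-elim : ∀ {ℓ} {P : Fin (a ℕ.* p ℕ.+ b ℕ.* q) → Set ℓ} →
    (∀ x t → P (ι₁ x t)) → (∀ y t → P (ι₂ y t)) → ∀ i → P i
  ι-elim {P = P} P₁ P₂ i with splitAt (a ℕ.* p) i in split≡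
  ... | inj₁ k = subst P (FinP.splitAt⁻¹-↑ˡ split≡)
                   (subst (λ k → P (k ↑ˡ b ℕ.* q)) (FinP.combine-remQuot {a} p k) (uncurry P₁ (remQuot {a} p k)))
  ... | inj₂ k = subst P (FinP.splitAt⁻¹-↑ʳ split≡)
                   (subst (λ k → P (a ℕ.* p ↑ʳ k)) (FinP.combine-remQuot {b} q k) (uncurry P₂ (remQuot {b} q k)))

-- Defs has two separately defined sums, sumF over a field and sumℕ; both satisfy ∑-zero and ∑-suc by refl.
module FiniteSums {a} {A : Set a} {add mul : Op₂ A} {zero# one# : A}
  (isCommutativeSemiring : IsCommutativeSemiring _≡_ add mul zero# one#)
  (∑ : ∀ n → (Fin n → A) → A)
  (∑-zero : ∀ g → ∑ 0 g ≡ zero#)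
  (∑-suc : ∀ n g → ∑ (ℕ.suc n) g ≡ add (g zero) (∑ n (g ∘ suc))) where

  commutativeSemiring : CommutativeSemiring a a
  commutativeSemiring = record { isCommutativeSemiring = isCommutativeSemiring }

  open CommutativeSemiring commutativeSemiring
    using (_+_; _*_; 0#; +-assoc; +-identityˡ; +-identityʳ; *-comm; distribˡ; zeroʳ; +-commutativeSemigroup)
  open ≡-Reasoning

  ∑-cong : ∀ n {g h : Fin n → A} → (∀ i → g i ≡ h i) → ∑ n g ≡ ∑ n h
  ∑-cong ℕ.zero {g} {h} _ = trans (∑-zero g) (sym (∑-zero h))
  ∑-cong (ℕ.suc n) {g} {h} g≗h = begin
    ∑ (ℕ.suc n) g            ≡⟨ ∑-suc n g ⟩
    g zero + ∑ n (g ∘ suc)   ≡⟨ cong₂ _+_ (g≗h zero) (∑-cong n (g≗h ∘ suc)) ⟩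
    h zero + ∑ n (h ∘ suc)   ≡⟨ ∑-suc n h ⟨
    ∑ (ℕ.suc n) h            ∎

  ∑-0 : ∀ n {g : Fin n → A} → (∀ i → g i ≡ 0#) → ∑ n g ≡ 0#
  ∑-0 ℕ.zero {g} _ = ∑-zero g
  ∑-0 (ℕ.suc n) {g} g≗0 = begin
    ∑ (ℕ.suc n) g            ≡⟨ ∑-suc n g ⟩
    g zero + ∑ n (g ∘ suc)   ≡⟨ cong₂ _+_ (g≗0 zero) (∑-0 n (g≗0 ∘ suc)) ⟩
    0# + 0#                  ≡⟨ +-identityˡ 0# ⟩
    0#                       ∎

  ∑-distrib-+ : ∀ n (g h : Fin n → A) → ∑ n (λ i → g i + h i) ≡ ∑ n g + ∑ n h
  ∑-distrib-+ ℕ.zero g h = begin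
    ∑ 0 _        ≡⟨ ∑-zero _ ⟩
    0#           ≡⟨ +-identityˡ 0# ⟨
    0# + 0#      ≡⟨ cong₂ _+_ (∑-zero g) (∑-zero h) ⟨
    ∑ 0 g + ∑ 0 h ∎
  ∑-distrib-+ (ℕ.suc n) g h = begin
    ∑ (ℕ.suc n) (λ i → g i + h i)
      ≡⟨ ∑-suc n _ ⟩
    (g zero + h zero) + ∑ n (λ i → g (suc i) + h (suc i))
      ≡⟨ cong (_ +_) (∑-distrib-+ n (g ∘ suc) (h ∘ suc)) ⟩
    (g zero + h zero) + (∑ n (g ∘ suc) + ∑ n (h ∘ suc))
      ≡⟨ +-interchange (g zero) (h zero) _ _ ⟩
    (g zero + ∑ n (g ∘ suc)) + (h zero + ∑ n (h ∘ suc))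
      ≡⟨ cong₂ _+_ (∑-suc n g) (∑-suc n h) ⟨
    ∑ (ℕ.suc n) g + ∑ (ℕ.suc n) h
      ∎
    where open CommutativeSemigroupProperties +-commutativeSemigroup
            renaming (interchange to +-interchange)

  *-distribˡ-∑ : ∀ n c (g : Fin n → A) → c * ∑ n g ≡ ∑ n (λ i → c * g i)
  *-distribˡ-∑ ℕ.zero c g = begin
    c * ∑ 0 g  ≡⟨ cong (c *_) (∑-zero g) ⟩
    c * 0#     ≡⟨ zeroʳ c ⟩
    0#         ≡⟨ ∑-zero _ ⟨
    ∑ 0 _      ∎
  *-distribˡ-∑ (ℕ.suc n) c g = begin
    c * ∑ (ℕ.suc n) g                     ≡⟨ cong (c *_) (∑-suc n g) ⟩
    c * (g zero + ∑ n (g ∘ suc))          ≡⟨ distribˡ c _ _ ⟩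
    c * g zero + c * ∑ n (g ∘ suc)        ≡⟨ cong (_ +_) (*-distribˡ-∑ n c (g ∘ suc)) ⟩
    c * g zero + ∑ n (λ i → c * g (suc i)) ≡⟨ ∑-suc n _ ⟨
    ∑ (ℕ.suc n) (λ i → c * g i)           ∎

  *-distribʳ-∑ : ∀ n c (g : Fin n → A) → ∑ n g * c ≡ ∑ n (λ i → g i * c)
  *-distribʳ-∑ n c g = begin
    ∑ n g * c                ≡⟨ *-comm _ c ⟩
    c * ∑ n g                ≡⟨ *-distribˡ-∑ n c g ⟩
    ∑ n (λ i → c * g i)      ≡⟨ ∑-cong n (λ i → *-comm c (g i)) ⟩
    ∑ n (λ i → g i * c)      ∎

  ∑-comm : ∀ m n (g : Fin m → Fin n → A) →
    ∑ m (λ i → ∑ n (g i)) ≡ ∑ n (λ j → ∑ m (λ i → g i j))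
  ∑-comm ℕ.zero n g = begin
    ∑ 0 _                        ≡⟨ ∑-zero _ ⟩
    0#                           ≡⟨ ∑-0 n (λ _ → ∑-zero _) ⟨
    ∑ n (λ j → ∑ 0 (λ i → g i j)) ∎
  ∑-comm (ℕ.suc m) n g = begin
    ∑ (ℕ.suc m) (λ i → ∑ n (g i))
      ≡⟨ ∑-suc m _ ⟩
    ∑ n (g zero) + ∑ m (λ i → ∑ n (g (suc i)))
      ≡⟨ cong (∑ n (g zero) +_) (∑-comm m n (g ∘ suc)) ⟩
    ∑ n (g zero) + ∑ n (λ j → ∑ m (λ i → g (suc i) j))
      ≡⟨ ∑-distrib-+ n _ _ ⟨
    ∑ n (λ j → g zero j + ∑ m (λ i → g (suc i) j))
      ≡⟨ ∑-cong n (λ j → ∑-suc m (λ i → g i j)) ⟨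
    ∑ n (λ j → ∑ (ℕ.suc m) (λ i → g i j))
      ∎

  ∑-++ : ∀ m n (g : Fin (m ℕ.+ n) → A) →
    ∑ (m ℕ.+ n) g ≡ ∑ m (λ i → g (i ↑ˡ n)) + ∑ n (λ j → g (m ↑ʳ j))
  ∑-++ ℕ.zero n g = begin
    ∑ n g              ≡⟨ +-identityˡ _ ⟨
    0# + ∑ n g         ≡⟨ cong (_+ ∑ n g) (∑-zero _) ⟨
    ∑ 0 _ + ∑ n g      ∎
  ∑-++ (ℕ.suc m) n g = begin
    ∑ (ℕ.suc (m ℕ.+ n)) g
      ≡⟨ ∑-suc (m ℕ.+ n) g ⟩
    g zero + ∑ (m ℕ.+ n) (g ∘ suc)
      ≡⟨ cong (g zero +_) (∑-++ m n (g ∘ suc)) ⟩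
    g zero + (∑ m (λ i → g (suc (i ↑ˡ n))) + ∑ n (λ j → g (suc (m ↑ʳ j))))
      ≡⟨ +-assoc _ _ _ ⟨
    (g zero + ∑ m (λ i → g (suc (i ↑ˡ n)))) + ∑ n (λ j → g (suc (m ↑ʳ j)))
      ≡⟨ cong (_+ _) (∑-suc m _) ⟨
    ∑ (ℕ.suc m) (λ i → g (i ↑ˡ n)) + ∑ n (λ j → g (ℕ.suc m ↑ʳ j))
      ∎

  ∑-splitAt : ∀ m {n} (h : Fin m ⊎ Fin n → A) →
    ∑ (m ℕ.+ n) (h ∘ splitAt m) ≡ ∑ m (h ∘ inj₁) + ∑ n (h ∘ inj₂)
  ∑-splitAt m {n} h = trans (∑-++ m n (h ∘ splitAt m))
    (cong₂ _+_ (∑-cong m (λ i → cong h (splitAt-↑ˡ m i n)))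
               (∑-cong n (λ j → cong h (splitAt-↑ʳ m n j))))

  ∑-remQuot : ∀ m n (g : Fin m → Fin n → A) →
    ∑ (m ℕ.* n) (uncurry g ∘ remQuot {m} n) ≡ ∑ m (λ i → ∑ n (g i))
  ∑-remQuot ℕ.zero n g = trans (∑-zero _) (sym (∑-zero _))
  ∑-remQuot (ℕ.suc m) n g = begin
    ∑ (n ℕ.+ m ℕ.* n) G
      ≡⟨ ∑-++ n (m ℕ.* n) G ⟩
    ∑ n (λ i → G (i ↑ˡ m ℕ.* n)) + ∑ (m ℕ.* n) (λ j → G (n ↑ʳ j))
      ≡⟨ cong₂ _+_ (∑-cong n (λ i → cong (uncurry g) (FinP.remQuot-combine {ℕ.suc m} zero i)))
                   (∑-cong (m ℕ.* n) (λ j → cong (uncurry g) (remQuot-↑ʳ j))) ⟩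
    ∑ n (g zero) + ∑ (m ℕ.* n) (uncurry (g ∘ suc) ∘ remQuot {m} n)
      ≡⟨ cong (∑ n (g zero) +_) (∑-remQuot m n (g ∘ suc)) ⟩
    ∑ n (g zero) + ∑ m (λ i → ∑ n (g (suc i)))
      ≡⟨ ∑-suc m _ ⟨
    ∑ (ℕ.suc m) (λ i → ∑ n (g i))
      ∎
    where
    G = uncurry g ∘ remQuot {ℕ.suc m} n
    remQuot-↑ʳ : ∀ j → remQuot {ℕ.suc m} n (n ↑ʳ j) ≡ map₁ suc (remQuot {m} n j)
    remQuot-↑ʳ j rewrite splitAt-↑ʳ n (m ℕ.* n) j = refl

  module _ (a p b q : ℕ) where

    open BlockIndex {a} {p} {b} {q}

    ∑-ι : ∀ (g : Fin (a ℕ.* p ℕ.+ b ℕ.* q) → A) →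
      ∑ (a ℕ.* p ℕ.+ b ℕ.* q) g ≡ ∑ a (λ x → ∑ p (λ t → g (ι₁ x t))) + ∑ b (λ y → ∑ q (λ t → g (ι₂ y t)))
    ∑-ι g = trans (∑-++ (a ℕ.* p) (b ℕ.* q) g) (cong₂ _+_
      (trans (∑-cong (a ℕ.* p) (λ k → cong (λ k → g (k ↑ˡ b ℕ.* q)) (sym (FinP.combine-remQuot {a} p k))))
             (∑-remQuot a p (λ x t → g (ι₁ x t))))
      (trans (∑-cong (b ℕ.* q) (λ k → cong (λ k → g (a ℕ.* p ↑ʳ k)) (sym (FinP.combine-remQuot {b} q k))))
             (∑-remQuot b q (λ y t → g (ι₂ y t)))))

  ∑-punchIn : ∀ n (g : Fin (ℕ.suc n) → A) j → ∑ (ℕ.suc n) g ≡ g j + ∑ n (g ∘ punchIn j)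
  ∑-punchIn n g zero = ∑-suc n g
  ∑-punchIn (ℕ.suc n) g (suc j) = begin
    ∑ (ℕ.suc (ℕ.suc n)) g                              ≡⟨ ∑-suc (ℕ.suc n) g ⟩
    g zero + ∑ (ℕ.suc n) (g ∘ suc)                     ≡⟨ cong (g zero +_) (∑-punchIn n (g ∘ suc) j) ⟩
    g zero + (g (suc j) + ∑ n (g ∘ suc ∘ punchIn j))   ≡⟨ x∙yz≈y∙xz _ _ _ ⟩
    g (suc j) + (g zero + ∑ n (g ∘ suc ∘ punchIn j))   ≡⟨ cong (g (suc j) +_) (∑-suc n _) ⟨
    g (suc j) + ∑ (ℕ.suc n) (g ∘ punchIn (suc j))      ∎
    where open CommutativeSemigroupProperties +-commutativeSemigroup using (x∙yz≈y∙xz)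

  ∑-single : ∀ n (g : Fin n → A) j → (∀ i → i ≢ j → g i ≡ 0#) → ∑ n g ≡ g j
  ∑-single (ℕ.suc n) g j g≡0 = begin
    ∑ (ℕ.suc n) g                 ≡⟨ ∑-punchIn n g j ⟩
    g j + ∑ n (g ∘ punchIn j)     ≡⟨ cong (g j +_) (∑-0 n (λ i → g≡0 (punchIn j i) (punchInᵢ≢i j i))) ⟩
    g j + 0#                      ≡⟨ +-identityʳ (g j) ⟩
    g j                           ∎

module Counting where

  open import Data.Nat using (_+_; _*_; _∸_; _≤_; z≤n; s≤s)
  open FiniteSums ℕP.+-*-isCommutativeSemiring sumℕ (λ _ → refl) (λ _ _ → refl) public
  open ≡-Reasoning

  indicator : Bool → ℕ
  indicator b = if b then 1 else 0

  ∑-const : ∀ n c → sumℕ n (λ _ → c) ≡ n * c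
  ∑-const ℕ.zero c = refl
  ∑-const (ℕ.suc n) c = cong (c +_) (∑-const n c)

  ∑-indicator≤ : ∀ n (g : Fin n → Bool) → sumℕ n (indicator ∘ g) ≤ n
  ∑-indicator≤ ℕ.zero g = z≤n
  ∑-indicator≤ (ℕ.suc n) g = ℕP.+-mono-≤ (indicator≤1 (g zero)) (∑-indicator≤ n (g ∘ suc))
    where
    indicator≤1 : ∀ b → indicator b ≤ 1
    indicator≤1 true = s≤s z≤n
    indicator≤1 false = z≤n

  ∑-indicator+∑-indicator-not : ∀ n (g : Fin n → Bool) →
    sumℕ n (indicator ∘ g) + sumℕ n (indicator ∘ not ∘ g) ≡ n
  ∑-indicator+∑-indicator-not n g = begin
    sumℕ n (indicator ∘ g) + sumℕ n (indicator ∘ not ∘ g)  ≡⟨ ∑-distrib-+ n _ _ ⟨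
    sumℕ n (λ i → indicator (g i) + indicator (not (g i)))  ≡⟨ ∑-cong n (λ i → one (g i)) ⟩
    sumℕ n (λ _ → 1)                                        ≡⟨ ∑-const n 1 ⟩
    n * 1                                                    ≡⟨ ℕP.*-identityʳ n ⟩
    n                                                        ∎
    where
    one : ∀ b → indicator b + indicator (not b) ≡ 1
    one true = refl
    one false = refl

  ∑∑ : ∀ k (r : Fin k → ℕ) → (Σ (Fin k) (Fin ∘ r) → ℕ) → ℕ
  ∑∑ k r f = sumℕ k (λ i → sumℕ (r i) (λ j → f (i , j)))

  ∑∑-distrib-+ : ∀ k r (f g : Σ (Fin k) (Fin ∘ r) → ℕ) → ∑∑ k r (λ m → f m + g m) ≡ ∑∑ k r f + ∑∑ k r g
  ∑∑-distrib-+ k r f g = trans (∑-cong k (λ i → ∑-distrib-+ (r i) _ _)) (∑-distrib-+ k _ _)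

  *-distribˡ-∑∑ : ∀ k r c (f : Σ (Fin k) (Fin ∘ r) → ℕ) → c * ∑∑ k r f ≡ ∑∑ k r (λ m → c * f m)
  *-distribˡ-∑∑ k r c f = trans (*-distribˡ-∑ k c _) (∑-cong k (λ i → *-distribˡ-∑ (r i) c _))

  ∑∑-indicator+∑∑-indicator-not : ∀ k r (D : Σ (Fin k) (Fin ∘ r) → Bool) →
    ∑∑ k r (indicator ∘ D) + ∑∑ k r (indicator ∘ not ∘ D) ≡ sumℕ k r
  ∑∑-indicator+∑∑-indicator-not k r D =
    trans (sym (∑-distrib-+ k _ _)) (∑-cong k (λ i → ∑-indicator+∑-indicator-not (r i) (λ j → D (i , j))))

  -- decoded messages of the product plus its rate, against n₂(d₁ + p₁) + n₁(d₂ + p₂) messages; t = |f₂(T₂)|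
  product-rate-arithmetic : ∀ n₁ n₂ d₁ d₂ p₁ p₂ t → t ≤ n₂ →
    (n₂ * d₁ + t * p₁ + n₁ * d₂) + (n₁ * p₂ + n₂ * p₁ ∸ p₁ * t) ≡ (d₁ + p₁) * n₂ + (d₂ + p₂) * n₁
  product-rate-arithmetic n₁ n₂ d₁ d₂ p₁ p₂ t t≤n₂ = begin
    (n₂ * d₁ + t * p₁ + n₁ * d₂) + q                 ≡⟨ regroup (n₂ * d₁) t p₁ (n₁ * d₂) q ⟩
    (n₂ * d₁ + n₁ * d₂) + (q + p₁ * t)               ≡⟨ cong ((n₂ * d₁ + n₁ * d₂) +_) (ℕP.m∸n+n≡m p₁t≤) ⟩
    (n₂ * d₁ + n₁ * d₂) + (n₁ * p₂ + n₂ * p₁)        ≡⟨ expand n₁ n₂ d₁ d₂ p₁ p₂ ⟩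
    (d₁ + p₁) * n₂ + (d₂ + p₂) * n₁                  ∎
    where
    open import Data.Nat.Tactic.RingSolver using (solve-∀)
    q = n₁ * p₂ + n₂ * p₁ ∸ p₁ * t
    p₁t≤ : p₁ * t ≤ n₁ * p₂ + n₂ * p₁
    p₁t≤ = ℕP.≤-trans (ℕP.*-monoʳ-≤ p₁ t≤n₂) (ℕP.≤-trans (ℕP.≤-reflexive (ℕP.*-comm p₁ n₂)) (ℕP.m≤n+m (n₂ * p₁) (n₁ * p₂)))
    regroup : ∀ a t p c d → (a + t * p + c) + d ≡ (a + c) + (d + p * t)
    regroup = solve-∀
    expand : ∀ n₁ n₂ d₁ d₂ p₁ p₂ → (n₂ * d₁ + n₁ * d₂) + (n₁ * p₂ + n₂ * p₁) ≡ (d₁ + p₁) * n₂ + (d₂ + p₂) * n₁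
    expand = solve-∀

  complement-arithmetic : ∀ a b c d n → c + d ≡ n → a + n * b ∸ b * c ≡ a + d * b
  complement-arithmetic a b c d n c+d≡n = begin
    a + n * b ∸ b * c               ≡⟨ cong (λ x → a + x * b ∸ b * c) (sym c+d≡n) ⟩
    a + (c + d) * b ∸ b * c         ≡⟨ cong (_∸ b * c) (regroup a b c d) ⟩
    (a + d * b) + b * c ∸ b * c     ≡⟨ ℕP.m+n∸n≡m (a + d * b) (b * c) ⟩
    a + d * b                       ∎
    where
    open import Data.Nat.Tactic.RingSolver using (solve-∀)
    regroup : ∀ a b c d → a + (c + d) * b ≡ (a + d * b) + b * c
    regroup = solve-∀

  enumerate-false : ∀ n (g : Fin n → Bool) →
    Σ[ s ∈ (Fin (sumℕ n (indicator ∘ not ∘ g)) → Fin n) ] ((∀ j → g (s j) ≡ false) × (∀ {j j'} → s j ≡ s j' → j ≡ j'))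
  enumerate-false ℕ.zero g = (λ ()) , (λ ()) , λ {}
  enumerate-false (ℕ.suc n) g with g zero in g₀≡ | enumerate-false n (g ∘ suc)
  ... | true | s , s-false , s-injective = suc ∘ s , s-false , s-injective ∘ FinP.suc-injective
  ... | false | s , s-false , s-injective = zero Vec.∷ suc ∘ s , s'-false , s'-injective
    where
    s'-false : ∀ j → g ((zero Vec.∷ suc ∘ s) j) ≡ false
    s'-false zero = g₀≡
    s'-false (suc j) = s-false j
    s'-injective : ∀ {j j'} → (zero Vec.∷ suc ∘ s) j ≡ (zero Vec.∷ suc ∘ s) j' → j ≡ j'
    s'-injective {zero} {zero} _ = refl
    s'-injective {suc j} {suc j'} sⱼ≡sⱼ' = cong suc (s-injective (FinP.suc-injective sⱼ≡sⱼ'))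

module FieldProperties (F : FiniteField) where

  open FiniteField F public using (Carrier; 0#; 1#; 0≢1)
  open FiniteField F using (isCommutativeRing; enumeration; inverse)
  open LinAlg F public

  commutativeRing : CommutativeRing _ _
  commutativeRing = record { isCommutativeRing = isCommutativeRing }

  open CommutativeRing commutativeRing public
    using (_+_; _*_; -_; +-assoc; +-comm; +-identityˡ; +-identityʳ; -‿inverseʳ;
           *-assoc; *-comm; *-identityˡ; *-identityʳ; distribˡ; distribʳ; zeroˡ; zeroʳ)
  open RingProperties (CommutativeRing.ring commutativeRing) public
    using (-‿distribˡ-*; -‿distribʳ-*; +-inverseʳ-unique)
  open CommutativeSemigroupProperties (CommutativeRing.*-commutativeSemigroup commutativeRing) public
    using (x∙yz≈y∙xz; interchange)
  open FiniteSums (CommutativeRing.isCommutativeSemiring commutativeRing) sumF (λ _ → refl) (λ _ _ → refl) public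

  open ≡-Reasoning

  infix 4 _≟_
  _≟_ : (x y : Carrier) → Dec (x ≡ y)
  x ≟ y with Inverse.from enumeration x FinP.≟ Inverse.from enumeration y
  ... | yes p = yes (from-injective enumeration p)
  ... | no ¬p = no (¬p ∘ cong (Inverse.from enumeration))

  any? : {P : Carrier → Set} → (∀ x → Dec (P x)) → Dec (∃ P)
  any? {P} P? = map′ (λ (i , p) → _ , p)
    (λ (x , p) → Inverse.from enumeration x , subst P (sym (Inverse.strictlyInverseˡ enumeration x)) p)
    (FinP.any? (P? ∘ Inverse.to enumeration))

  1≢0 : 1# ≢ 0#
  1≢0 = 0≢1 ∘ sym

  inv : (x : Carrier) → x ≢ 0# → Carrier
  inv x x≢0 = proj₁ (inverse x x≢0)

  inv-*-inverseˡ : ∀ {x} (x≢0 : x ≢ 0#) → inv x x≢0 * x ≡ 1#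
  inv-*-inverseˡ {x} x≢0 = trans (*-comm _ x) (proj₂ (inverse x x≢0))

  inv-*-cancelˡ : ∀ {x} (x≢0 : x ≢ 0#) y → inv x x≢0 * (x * y) ≡ y
  inv-*-cancelˡ {x} x≢0 y = begin
    inv x x≢0 * (x * y)      ≡⟨ *-assoc _ x y ⟨
    (inv x x≢0 * x) * y      ≡⟨ cong (_* y) (inv-*-inverseˡ x≢0) ⟩
    1# * y                   ≡⟨ *-identityˡ y ⟩
    y                        ∎

  x≢0∧x*y≡0⇒y≡0 : ∀ {x y} → x ≢ 0# → x * y ≡ 0# → y ≡ 0#
  x≢0∧x*y≡0⇒y≡0 {x} {y} x≢0 xy≡0 =
    trans (sym (inv-*-cancelˡ x≢0 y)) (trans (cong (inv x x≢0 *_) xy≡0) (zeroʳ _))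

  x*y≢0 : ∀ {x y} → x ≢ 0# → y ≢ 0# → x * y ≢ 0#
  x*y≢0 x≢0 y≢0 = y≢0 ∘ x≢0∧x*y≡0⇒y≡0 x≢0

  x*y≢0⇒x≢0 : ∀ {x y} → x * y ≢ 0# → x ≢ 0#
  x*y≢0⇒x≢0 {x} {y} xy≢0 x≡0 = xy≢0 (trans (cong (_* y) x≡0) (zeroˡ y))

  x*y≢0⇒y≢0 : ∀ {x y} → x * y ≢ 0# → y ≢ 0#
  x*y≢0⇒y≢0 {x} {y} xy≢0 y≡0 = xy≢0 (trans (cong (x *_) y≡0) (zeroʳ x))

  ∑-neg : ∀ n (g : Fin n → Carrier) → sumF n (λ i → - g i) ≡ - sumF n g
  ∑-neg n g = +-inverseʳ-unique (sumF n g) _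
    (trans (sym (∑-distrib-+ n g (λ i → - g i))) (∑-0 n (λ i → -‿inverseʳ (g i))))

  δ : ∀ {n} → Fin n → Fin n → Carrier
  δ i j = if does (i FinP.≟ j) then 1# else 0#

  δ-refl : ∀ {n} (i : Fin n) → δ i i ≡ 1#
  δ-refl i with i FinP.≟ i
  ... | yes _ = refl
  ... | no i≢i = ⊥-elim (i≢i refl)

  ∑-δ : ∀ n (i : Fin n) (g : Fin n → Carrier) → sumF n (λ j → δ i j * g j) ≡ g i
  ∑-δ n i g = trans (∑-single n _ i δ≡0) (trans (cong (_* g i) (δ-refl i)) (*-identityˡ (g i)))
    where
    δ≡0 : ∀ j → j ≢ i → δ i j * g j ≡ 0#
    δ≡0 j j≢i with i FinP.≟ j
    ... | yes i≡j = ⊥-elim (j≢i (sym i≡j))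
    ... | no _ = zeroˡ (g j)

module Independence (F : FiniteField) {R : Set}
  (all? : ∀ {P : R → Set} → (∀ r → Dec (P r)) → Dec (∀ r → P r)) where

  open FieldProperties F
  open ≡-Reasoning

  combination : ∀ {ρ} → (Fin ρ → Carrier) → (Fin ρ → R → Carrier) → R → Carrier
  combination {ρ} β c r = sumF ρ (λ t → β t * c t r)

  Independent : ∀ {ρ} → (Fin ρ → R → Carrier) → Set
  Independent {ρ} c = ∀ β → (∀ r → combination β c r ≡ 0#) → ∀ t → β t ≡ 0#

  NontrivialRelation : ∀ {ρ} → (Fin ρ → R → Carrier) → (Fin ρ → Carrier) → Set
  NontrivialRelation c β = (∀ r → combination β c r ≡ 0#) × ∃[ t ] β t ≢ 0#

  Dependent : ∀ {ρ} → (Fin ρ → R → Carrier) → Set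
  Dependent c = ∃ (NontrivialRelation c)

  Spans : ∀ {N ρ} → (Fin N → R → Carrier) → (Fin ρ → Fin N → Carrier) → (Fin ρ → R → Carrier) → Set
  Spans c α w = ∀ t r → w t r ≡ combination (α t) c r

  combination-cong : ∀ {ρ} {β β' : Fin ρ → Carrier} (c : Fin ρ → R → Carrier) →
    (∀ t → β t ≡ β' t) → ∀ r → combination β c r ≡ combination β' c r
  combination-cong {ρ} c β≗β' r = ∑-cong ρ (λ t → cong (_* c t r) (β≗β' t))

  any-vector? : ∀ ρ {P : (Fin ρ → Carrier) → Set} →
    (∀ {β β'} → (∀ t → β t ≡ β' t) → P β → P β') →
    (∀ β → Dec (P β)) → Dec (∃ P)
  any-vector? ℕ.zero resp P? = map′ (λ p → _ , p) (λ (β , p) → resp (λ ()) p) (P? (λ ()))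
  any-vector? (ℕ.suc ρ) resp P? =
    map′ (λ (x , γ , p) → x Vec.∷ γ , p)
         (λ (β , p) → β zero , β ∘ suc , resp (λ { zero → refl ; (suc t) → refl }) p)
         (any? (λ x → any-vector? ρ (λ γ≗γ' → resp (λ { zero → refl ; (suc t) → γ≗γ' t })) (P? ∘ (x Vec.∷_))))

  nontrivialRelation? : ∀ {ρ} (c : Fin ρ → R → Carrier) β → Dec (NontrivialRelation c β)
  nontrivialRelation? c β = all? (λ r → combination β c r ≟ 0#) ×-dec FinP.any? (λ t → ¬? (β t ≟ 0#))

  NontrivialRelation-resp : ∀ {ρ} (c : Fin ρ → R → Carrier) {β β'} → (∀ t → β t ≡ β' t) →
    NontrivialRelation c β → NontrivialRelation c β'
  NontrivialRelation-resp c β≗β' (β·c≡0 , t , βₜ≢0) =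
    (λ r → trans (sym (combination-cong c β≗β' r)) (β·c≡0 r)) , t , βₜ≢0 ∘ trans (β≗β' t)

  -- by exhaustive search over the finitely many coefficient vectors
  independent-or-dependent : ∀ {ρ} (c : Fin ρ → R → Carrier) → Independent c ⊎ Dependent c
  independent-or-dependent {ρ} c with any-vector? ρ (NontrivialRelation-resp c) (nontrivialRelation? c)
  ... | yes dependent = inj₂ dependent
  ... | no ¬dependent = inj₁ λ β β·c≡0 t → decidable-stable (β t ≟ 0#)
    λ βₜ≢0 → ¬dependent (β , β·c≡0 , t , βₜ≢0)

  combination-linear : ∀ {ρ} (β γ : Fin ρ → Carrier) k (c : Fin ρ → R → Carrier) r →
    combination (λ t → β t + k * γ t) c r ≡ combination β c r + k * combination γ c r
  combination-linear {ρ} β γ k c r = begin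
    sumF ρ (λ t → (β t + k * γ t) * c t r)
      ≡⟨ ∑-cong ρ (λ t → trans (distribʳ (c t r) (β t) _) (cong (β t * c t r +_) (*-assoc k (γ t) (c t r)))) ⟩
    sumF ρ (λ t → β t * c t r + k * (γ t * c t r))
      ≡⟨ ∑-distrib-+ ρ _ _ ⟩
    combination β c r + sumF ρ (λ t → k * (γ t * c t r))
      ≡⟨ cong (combination β c r +_) (*-distribˡ-∑ ρ k _) ⟨
    combination β c r + k * combination γ c r
      ∎

  combination-subfamily : ∀ {N ρ} (c : Fin N → R → Carrier) (col : Fin ρ → Fin N) (ν : Fin ρ → Carrier) r →
    combination ν (c ∘ col) r ≡ combination (λ s → sumF ρ (λ t → ν t * δ (col t) s)) c r
  combination-subfamily {N} {ρ} c col ν r = begin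
    sumF ρ (λ t → ν t * c (col t) r)
      ≡⟨ ∑-cong ρ (λ t → cong (ν t *_) (∑-δ N (col t) (λ s → c s r))) ⟨
    sumF ρ (λ t → ν t * sumF N (λ s → δ (col t) s * c s r))
      ≡⟨ ∑-cong ρ (λ t → *-distribˡ-∑ N (ν t) _) ⟩
    sumF ρ (λ t → sumF N (λ s → ν t * (δ (col t) s * c s r)))
      ≡⟨ ∑-comm ρ N _ ⟩
    sumF N (λ s → sumF ρ (λ t → ν t * (δ (col t) s * c s r)))
      ≡⟨ ∑-cong N (λ s → trans (∑-cong ρ (λ t → sym (*-assoc (ν t) _ _))) (sym (*-distribʳ-∑ ρ (c s r) _))) ⟩
    sumF N (λ s → sumF ρ (λ t → ν t * δ (col t) s) * c s r)
      ∎

  ¬Independent-zeros : ∀ {ρ} (w : Fin (ℕ.suc ρ) → R → Carrier) → (∀ t r → w t r ≡ 0#) → ¬ Independent w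
  ¬Independent-zeros {ρ} w w≡0 independent = 1≢0 (independent (λ _ → 1#) trivial zero)
    where
    trivial : ∀ r → combination (λ _ → 1#) w r ≡ 0#
    trivial r = ∑-0 (ℕ.suc ρ) (λ t → trans (cong (1# *_) (w≡0 t r)) (zeroʳ 1#))

  Spans-tail : ∀ {N ρ} {c : Fin (ℕ.suc N) → R → Carrier} {α : Fin ρ → Fin (ℕ.suc N) → Carrier} {w} →
    (∀ t → α t zero ≡ 0#) → Spans c α w → Spans (c ∘ suc) (λ t → α t ∘ suc) w
  Spans-tail {c = c} {α} {w} α₀≡0 span t r = begin
    w t r                        ≡⟨ span t r ⟩
    α t zero * c zero r + rest   ≡⟨ cong (λ x → x * c zero r + rest) (α₀≡0 t) ⟩
    0# * c zero r + rest         ≡⟨ cong (_+ rest) (zeroˡ (c zero r)) ⟩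
    0# + rest                    ≡⟨ +-identityˡ rest ⟩
    rest                         ∎
    where rest = combination (α t ∘ suc) (c ∘ suc) r

  Spans-substitute-head : ∀ {N ρ} {c : Fin (ℕ.suc N) → R → Carrier} {α : Fin ρ → Fin (ℕ.suc N) → Carrier} {w}
    (ν : Fin N → Carrier) → (∀ r → c zero r ≡ combination ν (c ∘ suc) r) →
    Spans c α w → Spans (c ∘ suc) (λ t s → α t (suc s) + α t zero * ν s) w
  Spans-substitute-head {N} {c = c} {α} {w} ν c₀≡ν·c span t r = begin
    w t r
      ≡⟨ span t r ⟩
    α t zero * c zero r + rest
      ≡⟨ cong (λ x → α t zero * x + rest) (c₀≡ν·c r) ⟩
    α t zero * combination ν (c ∘ suc) r + rest
      ≡⟨ +-comm _ rest ⟩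
    rest + α t zero * combination ν (c ∘ suc) r
      ≡⟨ combination-linear (α t ∘ suc) ν (α t zero) (c ∘ suc) r ⟨
    combination (λ s → α t (suc s) + α t zero * ν s) (c ∘ suc) r
      ∎
    where rest = combination (α t ∘ suc) (c ∘ suc) r

  -- β₀ ≠ 0 because the tail is independent, and then e₀ = −β₀⁻¹ Σₜ βₜ₊₁ eₜ₊₁.
  Dependent⇒head-spanned : ∀ {ρ} (e : Fin (ℕ.suc ρ) → R → Carrier) → Independent (e ∘ suc) → Dependent e →
    ∃[ ν ] ∀ r → e zero r ≡ combination ν (e ∘ suc) r
  Dependent⇒head-spanned {ρ} e tail-independent (β , β·e≡0 , t , βₜ≢0) =
    (λ t → - (β₀⁻¹ * β (suc t))) , e₀≡ν·e
    where
    β₀≢0 : β zero ≢ 0#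
    β₀≢0 β₀≡0 = βₜ≢0 (β≡0 t)
      where
      tail≡0 : ∀ r → combination (β ∘ suc) (e ∘ suc) r ≡ 0#
      tail≡0 r = begin
        rest                          ≡⟨ +-identityˡ rest ⟨
        0# + rest                     ≡⟨ cong (_+ rest) (trans (cong (_* e zero r) β₀≡0) (zeroˡ (e zero r))) ⟨
        β zero * e zero r + rest      ≡⟨ β·e≡0 r ⟩
        0#                            ∎
        where rest = combination (β ∘ suc) (e ∘ suc) r
      β≡0 : ∀ t → β t ≡ 0#
      β≡0 zero = β₀≡0
      β≡0 (suc t) = tail-independent (β ∘ suc) tail≡0 t
    β₀⁻¹ = inv (β zero) β₀≢0
    e₀≡ν·e : ∀ r → e zero r ≡ combination (λ t → - (β₀⁻¹ * β (suc t))) (e ∘ suc) r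
    e₀≡ν·e r = begin
      e zero r
        ≡⟨ inv-*-cancelˡ β₀≢0 (e zero r) ⟨
      β₀⁻¹ * (β zero * e zero r)
        ≡⟨ cong (β₀⁻¹ *_) (+-inverseʳ-unique rest _ (trans (+-comm rest _) (β·e≡0 r))) ⟩
      β₀⁻¹ * - rest
        ≡⟨ -‿distribʳ-* β₀⁻¹ rest ⟨
      - (β₀⁻¹ * rest)
        ≡⟨ cong -_ (*-distribˡ-∑ ρ β₀⁻¹ _) ⟩
      - sumF ρ (λ t → β₀⁻¹ * (β (suc t) * e (suc t) r))
        ≡⟨ ∑-neg ρ _ ⟨
      sumF ρ (λ t → - (β₀⁻¹ * (β (suc t) * e (suc t) r)))
        ≡⟨ ∑-cong ρ (λ t → trans (cong -_ (sym (*-assoc _ _ _))) (-‿distribˡ-* _ _)) ⟩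
      combination (λ t → - (β₀⁻¹ * β (suc t))) (e ∘ suc) r
        ∎
      where rest = combination (β ∘ suc) (e ∘ suc) r

  Independent-resp : ∀ {ρ} {c c' : Fin ρ → R → Carrier} → (∀ t r → c t r ≡ c' t r) →
    Independent c → Independent c'
  Independent-resp {ρ} c≗c' independent β β·c'≡0 =
    independent β (λ r → trans (∑-cong ρ (λ t → cong (β t *_) (c≗c' t r))) (β·c'≡0 r))

  Independent⇒≢0 : ∀ {ρ} {c : Fin ρ → R → Carrier} → Independent c → ∀ t → ¬ (∀ r → c t r ≡ 0#)
  Independent⇒≢0 {ρ} {c} independent t cₜ≡0 =
    1≢0 (trans (sym (δ-refl t)) (independent (δ t) (λ r → trans (∑-δ ρ t (λ t' → c t' r)) (cₜ≡0 r)) t))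

  -- A relation β among the new vectors is the relation β with κ = Σ βₜμₜ inserted at t₀ among the old ones.
  Independent-add-multiple : ∀ {ρ} {w : Fin (ℕ.suc ρ) → R → Carrier} (t₀ : Fin (ℕ.suc ρ)) (μ : Fin ρ → Carrier) →
    Independent w → Independent (λ t r → w (punchIn t₀ t) r + μ t * w t₀ r)
  Independent-add-multiple {ρ} {w} t₀ μ independent β β·w'≡0 t = begin
    β t                       ≡⟨ insertAt-punchIn β t₀ κ t ⟨
    γ (punchIn t₀ t)          ≡⟨ independent γ γ·w≡0 (punchIn t₀ t) ⟩
    0#                        ∎
    where
    κ = sumF ρ (λ t → β t * μ t)
    γ = Vec.insertAt β t₀ κ
    γ·w≡0 : ∀ r → combination γ w r ≡ 0#
    γ·w≡0 r = begin
      combination γ w r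
        ≡⟨ ∑-punchIn ρ (λ t → γ t * w t r) t₀ ⟩
      γ t₀ * w t₀ r + sumF ρ (λ t → γ (punchIn t₀ t) * w (punchIn t₀ t) r)
        ≡⟨ cong₂ _+_ (cong (_* w t₀ r) (insertAt-lookup β t₀ κ))
                     (∑-cong ρ (λ t → cong (_* w (punchIn t₀ t) r) (insertAt-punchIn β t₀ κ t))) ⟩
      κ * w t₀ r + combination β (λ t → w (punchIn t₀ t)) r
        ≡⟨ +-comm _ _ ⟩
      combination β (λ t → w (punchIn t₀ t)) r + κ * w t₀ r
        ≡⟨ cong (_ +_) (trans (*-distribʳ-∑ ρ (w t₀ r) _) (∑-cong ρ (λ t → *-assoc (β t) (μ t) (w t₀ r)))) ⟩
      combination β (λ t → w (punchIn t₀ t)) r + sumF ρ (λ t → β t * (μ t * w t₀ r))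
        ≡⟨ ∑-distrib-+ ρ _ _ ⟨
      sumF ρ (λ t → β t * w (punchIn t₀ t) r + β t * (μ t * w t₀ r))
        ≡⟨ ∑-cong ρ (λ t → distribˡ (β t) _ _) ⟨
      combination β (λ t r → w (punchIn t₀ t) r + μ t * w t₀ r) r
        ≡⟨ β·w'≡0 r ⟩
      0#
        ∎

  -- Subtracting μₜ = −αₜ₀/α_{t₀0} times the pivot vector clears the first coordinate of every other vector.
  eliminate-pivot : ∀ {N ρ} (c : Fin (ℕ.suc N) → R → Carrier) (α : Fin (ℕ.suc ρ) → Fin (ℕ.suc N) → Carrier)
    {w : Fin (ℕ.suc ρ) → R → Carrier} (t₀ : Fin (ℕ.suc ρ)) → α t₀ zero ≢ 0# → Spans c α w → Independent w →
    Σ[ α' ∈ (Fin ρ → Fin N → Carrier) ] Σ[ w' ∈ (Fin ρ → R → Carrier) ] (Spans (c ∘ suc) α' w' × Independent w')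
  eliminate-pivot {N} {ρ} c α {w} t₀ pivot≢0 span independent =
    (λ t → α″ t ∘ suc) , w' , Spans-tail {c = c} {α = α″} α″₀≡0 span″ , Independent-add-multiple {w = w} t₀ μ independent
    where
    μ : Fin ρ → Carrier
    μ t = - (α (punchIn t₀ t) zero * inv (α t₀ zero) pivot≢0)
    α″ : Fin ρ → Fin (ℕ.suc N) → Carrier
    α″ t s = α (punchIn t₀ t) s + μ t * α t₀ s
    w' : Fin ρ → R → Carrier
    w' t r = w (punchIn t₀ t) r + μ t * w t₀ r

    α″₀≡0 : ∀ t → α″ t zero ≡ 0#
    α″₀≡0 t = begin
      a + μ t * α t₀ zero                  ≡⟨ cong (a +_) (-‿distribˡ-* _ _) ⟨
      a + - ((a * a₀⁻¹) * α t₀ zero)       ≡⟨ cong (λ x → a + - x) (*-assoc a a₀⁻¹ _) ⟩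
      a + - (a * (a₀⁻¹ * α t₀ zero))       ≡⟨ cong (λ x → a + - (a * x)) (inv-*-inverseˡ pivot≢0) ⟩
      a + - (a * 1#)                       ≡⟨ cong (λ x → a + - x) (*-identityʳ a) ⟩
      a + - a                              ≡⟨ -‿inverseʳ a ⟩
      0#                                   ∎
      where a = α (punchIn t₀ t) zero; a₀⁻¹ = inv (α t₀ zero) pivot≢0

    span″ : Spans c α″ w'
    span″ t r = begin
      w (punchIn t₀ t) r + μ t * w t₀ r
        ≡⟨ cong₂ (λ x y → x + μ t * y) (span (punchIn t₀ t) r) (span t₀ r) ⟩
      combination (α (punchIn t₀ t)) c r + μ t * combination (α t₀) c r
        ≡⟨ combination-linear (α (punchIn t₀ t)) (α t₀) (μ t) c r ⟨
      combination (α″ t) c r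
        ∎

  -- Steinitz exchange: ρ independent vectors in the span of c force ρ independent vectors among the c's.
  independent-subfamily : ∀ N (c : Fin N → R → Carrier) {ρ} (α : Fin ρ → Fin N → Carrier) (w : Fin ρ → R → Carrier) →
    Spans c α w → Independent w → Σ[ col ∈ (Fin ρ → Fin N) ] Independent (c ∘ col)
  independent-subfamily N c {ℕ.zero} α w _ _ = (λ ()) , (λ _ _ ())
  independent-subfamily ℕ.zero c {ℕ.suc ρ} α w span independent =
    ⊥-elim (¬Independent-zeros w span independent)
  independent-subfamily (ℕ.suc N) c {ℕ.suc ρ} α w span independent
    with FinP.any? (λ t → ¬? (α t zero ≟ 0#))
  ... | no no-pivot =
    let (col , independent-col) = independent-subfamily N (c ∘ suc) (λ t → α t ∘ suc) w
          (Spans-tail {c = c} {α = α} (λ t → decidable-stable (α t zero ≟ 0#) (λ α₀≢0 → no-pivot (t , α₀≢0))) span) independent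
    in suc ∘ col , independent-col
  ... | yes (t₀ , pivot≢0)
    with eliminate-pivot c α t₀ pivot≢0 span independent
  ... | α' , w' , span' , independent'
    with independent-subfamily N (c ∘ suc) α' w' span' independent'
  ... | col' , independent-col'
    with independent-or-dependent (c ∘ (zero Vec.∷ suc ∘ col'))
  ... | inj₁ independent-extension = zero Vec.∷ suc ∘ col' , independent-extension
  -- c₀ then lies in the span of c ∘ suc and can be dropped.
  ... | inj₂ dependent-extension =
    let (ν , c₀≡ν·c) = Dependent⇒head-spanned (c ∘ (zero Vec.∷ suc ∘ col')) independent-col' dependent-extension
        ν' = λ s → sumF ρ (λ t → ν t * δ (col' t) s)
        (col , independent-col) = independent-subfamily N (c ∘ suc) (λ t s → α t (suc s) + α t zero * ν' s) w
          (Spans-substitute-head {c = c} {α = α} ν' (λ r → trans (c₀≡ν·c r) (combination-subfamily (c ∘ suc) col' ν r)) span)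
          independent
    in suc ∘ col , independent-col

anyFin-true : ∀ m (g : Fin m → Bool) i → g i ≡ true → anyFin m g ≡ true
anyFin-true (ℕ.suc m) g zero gᵢ≡true rewrite gᵢ≡true = refl
anyFin-true (ℕ.suc m) g (suc i) gᵢ≡true rewrite anyFin-true m (g ∘ suc) i gᵢ≡true with g zero
... | true = refl
... | false = refl

module Vertices (F : FiniteField) (N : Instance) where

  open FieldProperties F
  open Instance N
  open ≡-Reasoning

  to : Fin n → V
  to = Inverse.to vertices

  from : V → Fin n
  from = Inverse.from vertices

  to-from : ∀ v → to (from v) ≡ v
  to-from = Inverse.strictlyInverseˡ vertices

  from-to : ∀ i → from (to i) ≡ i
  from-to = Inverse.strictlyInverseʳ vertices

  eqV-complete : ∀ {u v} → u ≢ v → eqV u v ≡ false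
  eqV-complete {u} {v} u≢v with from u FinP.≟ from v
  ... | yes fu≡fv = ⊥-elim (u≢v (from-injective vertices fu≡fv))
  ... | no _ = refl

  ≡-or-≢ : ∀ u v → (u ≡ v) ⊎ (u ≢ v)
  ≡-or-≢ u v with from u FinP.≟ from v
  ... | yes fu≡fv = inj₁ (from-injective vertices fu≡fv)
  ... | no fu≢fv = inj₂ (fu≢fv ∘ cong from)

  adj⇒≢ : ∀ {u v} → adj u v ≡ true → u ≢ v
  adj⇒≢ {u} adj≡true refl with trans (sym adj≡true) (adj-irrefl u)
  ... | ()

  fT⇒fTall : ∀ i v → fT i v ≡ true → fTall v ≡ true
  fT⇒fTall i v = anyFin-true k (λ j → fT j v) i

  fS⇒fSall : ∀ i v → fS i v ≡ true → fSall v ≡ true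
  fS⇒fSall i v = anyFin-true k (λ j → fS j v) i

  all? : ∀ {P : V → Set} → (∀ v → Dec (P v)) → Dec (∀ v → P v)
  all? {P} P? = map′ (λ P-all v → subst P (to-from v) (P-all (from v))) (λ P-all → P-all ∘ to) (FinP.all? (P? ∘ to))

  ¬∀⇒∃¬ : ∀ {P : V → Set} → (∀ v → Dec (P v)) → ¬ (∀ v → P v) → ∃[ v ] ¬ P v
  ¬∀⇒∃¬ {P} P? ¬P-all with FinP.¬∀⟶∃¬ n (P ∘ to) (P? ∘ to) (λ P-all → ¬P-all (λ v → subst P (to-from v) (P-all (from v))))
  ... | i , ¬Pᵢ = to i , ¬Pᵢ

  -- definitionally equal to the identity matrices Id₁, Id₂ of ProductCode
  Id : V → V → Carrier
  Id u w = if eqV u w then 1# else 0#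

  Id-refl : ∀ u → Id u u ≡ 1#
  Id-refl u rewrite eqV-refl u = refl

  Id-≢ : ∀ {u w} → u ≢ w → Id u w ≡ 0#
  Id-≢ u≢w rewrite eqV-complete u≢w = refl

  Id≢0⇒≡ : ∀ {u w} → Id u w ≢ 0# → u ≡ w
  Id≢0⇒≡ {u} {w} Id≢0 with ≡-or-≢ u w
  ... | inj₁ u≡w = u≡w
  ... | inj₂ u≢w = ⊥-elim (Id≢0 (Id-≢ u≢w))

  ∑V : (V → Carrier) → Carrier
  ∑V g = sumF n (g ∘ to)

  ∑V-cong : ∀ {g h : V → Carrier} → (∀ v → g v ≡ h v) → ∑V g ≡ ∑V h
  ∑V-cong g≗h = ∑-cong n (g≗h ∘ to)

  ∑V-0 : ∀ {g : V → Carrier} → (∀ v → g v ≡ 0#) → ∑V g ≡ 0#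
  ∑V-0 g≗0 = ∑-0 n (g≗0 ∘ to)

  ∑V-single : ∀ (g : V → Carrier) w → (∀ v → v ≢ w → g v ≡ 0#) → ∑V g ≡ g w
  ∑V-single g w g≡0 = begin
    ∑V g              ≡⟨ ∑-single n (g ∘ to) (from w) (λ i i≢w → g≡0 (to i) (λ tᵢ≡w → i≢w (trans (sym (from-to i)) (cong from tᵢ≡w)))) ⟩
    g (to (from w))   ≡⟨ cong g (to-from w) ⟩
    g w               ∎

  ∑V-*Id : ∀ (g : V → Carrier) w → ∑V (λ v → g v * Id v w) ≡ g w
  ∑V-*Id g w = trans (∑V-single _ w (λ v v≢w → trans (cong (g v *_) (Id-≢ v≢w)) (zeroʳ (g v))))
                     (trans (cong (g w *_) (Id-refl w)) (*-identityʳ (g w)))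

  ∑V-Id* : ∀ (g : V → Carrier) w → ∑V (λ v → Id v w * g v) ≡ g w
  ∑V-Id* g w = trans (∑V-cong (λ v → *-comm (Id v w) (g v))) (∑V-*Id g w)

module CodeProperties (F : FiniteField) (N : Instance) (C : Codes.Code F N) where

  open FieldProperties F
  open Instance N
  open Codes F N using (Msg; LᵀI)
  open Codes.Code C
  open Vertices F N
  open ≡-Reasoning

  infix 8 _·L_
  _·L_ : (V → Carrier) → Msg r → Carrier
  a ·L m = Codes._·L F N C a m

  all-msg? : ∀ {P : Msg r → Set} → (∀ m → Dec (P m)) → Dec (∀ m → P m)
  all-msg? P? = map′ (λ P-all (i , j) → P-all i j) (λ P-all i j → P-all (i , j))
    (FinP.all? (λ i → FinP.all? (λ j → P? (i , j))))

  open Independence F all-msg? public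

  ∑M : (Msg r → Carrier) → Carrier
  ∑M g = sumF k (λ i → sumF (r i) (λ j → g (i , j)))

  ∑M-single : ∀ (g : Msg r → Carrier) m → (∀ m' → m' ≢ m → g m' ≡ 0#) → ∑M g ≡ g m
  ∑M-single g (i , j) g≡0 =
    trans (∑-single k _ i (λ i' i'≢i → ∑-0 (r i') (λ j' → g≡0 (i' , j') (i'≢i ∘ cong proj₁))))
          (∑-single (r i) _ j (λ j' j'≢j → g≡0 (i , j') (λ { refl → j'≢j refl })))

  ∑V-∑M-comm : (g : V → Msg r → Carrier) → ∑V (λ v → ∑M (g v)) ≡ ∑M (λ m → ∑V (λ v → g v m))
  ∑V-∑M-comm g = trans (∑-comm n k _) (∑-cong k (λ i → ∑-comm n (r i) _))

  ·L-∑M : ∀ (h : Msg r → V → Carrier) m' → (λ v → ∑M (λ m → h m v)) ·L m' ≡ ∑M (λ m → h m ·L m')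
  ·L-∑M h m' = begin
    ∑V (λ v → ∑M (λ m → h m v) * L v m')
      ≡⟨ ∑V-cong (λ v → trans (*-distribʳ-∑ k (L v m') _) (∑-cong k (λ i → *-distribʳ-∑ (r i) (L v m') (λ j → h (i , j) v)))) ⟩
    ∑V (λ v → ∑M (λ m → h m v * L v m'))
      ≡⟨ ∑V-∑M-comm (λ v m → h m v * L v m') ⟩
    ∑M (λ m → h m ·L m')
      ∎

  ·L-*ˡ : ∀ c (a : V → Carrier) m → (λ v → c * a v) ·L m ≡ c * (a ·L m)
  ·L-*ˡ c a m = trans (∑V-cong (λ v → *-assoc c (a v) (L v m))) (sym (*-distribˡ-∑ n c _))

  Decoders : (Msg r → Bool) → Set
  Decoders D = ∀ m → D m ≡ false → Σ[ d ∈ (V → Carrier) ]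
    (SuppSub d (λ u → fT (proj₁ m) u ≡ true) × InSupp (d ·L_) m × SuppSub (d ·L_) (λ m' → (m' ≡ m) ⊎ (D m' ≡ true)))

  -- Row w minus, for each undecoded m, the multiple of the decoder of m that cancels L[w,m].
  module ClearUndecoded (D : Msg r → Bool) (decoders : Decoders D) (w : V) (w∉fT : fTall w ≡ false) where

    decoder : ∀ m → D m ≡ false → V → Carrier
    decoder m undecoded = proj₁ (decoders m undecoded)

    coefficient : ∀ m → D m ≡ false → Carrier
    coefficient m undecoded =
      - (L w m * inv (decoder m undecoded ·L m) (proj₁ (proj₂ (proj₂ (decoders m undecoded)))))

    correction : ∀ m b → D m ≡ b → V → Carrier
    correction m true _ v = 0#
    correction m false undecoded v = coefficient m undecoded * decoder m undecoded v

    x : V → Carrier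
    x v = Id v w + ∑M (λ m → correction m (D m) refl v)

    decoder-supp : ∀ m undecoded v → fTall v ≡ false → decoder m undecoded v ≡ 0#
    decoder-supp m undecoded v v∉fT = decidable-stable (decoder m undecoded v ≟ 0#) λ dᵥ≢0 →
      case trans (sym (fT⇒fTall (proj₁ m) v (proj₁ (proj₂ (decoders m undecoded)) v dᵥ≢0))) v∉fT of λ ()

    x-outside : ∀ v → fTall v ≡ false → x v ≡ Id v w
    x-outside v v∉fT = trans (cong (Id v w +_) (∑-0 k (λ i → ∑-0 (r i) (λ j → correction≡0 (i , j) (D (i , j)) refl))))
                             (+-identityʳ _)
      where
      correction≡0 : ∀ m b undecoded → correction m b undecoded v ≡ 0#
      correction≡0 m true _ = refl
      correction≡0 m false undecoded = trans (cong (coefficient m undecoded *_) (decoder-supp m undecoded v v∉fT)) (zeroʳ _)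

    correction·L-other : ∀ m b (undecoded : D m ≡ b) m' → m' ≢ m → D m' ≡ false → correction m b undecoded ·L m' ≡ 0#
    correction·L-other m true _ m' _ _ = ∑V-0 (λ v → zeroˡ (L v m'))
    correction·L-other m false undecoded m' m'≢m m'-undecoded = begin
      correction m false undecoded ·L m'                   ≡⟨ ·L-*ˡ _ (decoder m undecoded) m' ⟩
      coefficient m undecoded * (decoder m undecoded ·L m') ≡⟨ cong (_ *_) d·L≡0 ⟩
      coefficient m undecoded * 0#                          ≡⟨ zeroʳ _ ⟩
      0#                                                     ∎
      where
      d·L≡0 : decoder m undecoded ·L m' ≡ 0#
      d·L≡0 = decidable-stable (decoder m undecoded ·L m' ≟ 0#) λ d·L≢0 →
        case proj₂ (proj₂ (proj₂ (decoders m undecoded))) m' d·L≢0 of λ where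
          (inj₁ m'≡m) → m'≢m m'≡m
          (inj₂ m'-decoded) → case trans (sym m'-decoded) m'-undecoded of λ ()

    correction·L-self : ∀ m b (undecoded : D m ≡ b) → D m ≡ false → correction m b undecoded ·L m ≡ - L w m
    correction·L-self m true m-decoded m-undecoded = case trans (sym m-decoded) m-undecoded of λ ()
    correction·L-self m false undecoded _ = begin
      correction m false undecoded ·L m                   ≡⟨ ·L-*ˡ _ (decoder m undecoded) m ⟩
      - (L w m * inv q q≢0) * q                           ≡⟨ -‿distribˡ-* _ q ⟨
      - ((L w m * inv q q≢0) * q)                         ≡⟨ cong -_ (*-assoc _ _ q) ⟩
      - (L w m * (inv q q≢0 * q))                         ≡⟨ cong (λ y → - (L w m * y)) (inv-*-inverseˡ q≢0) ⟩
      - (L w m * 1#)                                      ≡⟨ cong -_ (*-identityʳ _) ⟩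
      - L w m                                             ∎
      where
      q = decoder m undecoded ·L m
      q≢0 = proj₁ (proj₂ (proj₂ (decoders m undecoded)))

    x-w≢0 : x w ≢ 0#
    x-w≢0 x-w≡0 = 1≢0 (trans (sym (Id-refl w)) (trans (sym (x-outside w w∉fT)) x-w≡0))

    x-supp : ∀ v → x v ≢ 0# → (v ≡ w) ⊎ (fTall v ≡ true)
    x-supp v xᵥ≢0 with fTall v in v∈fT?
    ... | true = inj₂ refl
    ... | false = inj₁ (Id≢0⇒≡ (λ Id≡0 → xᵥ≢0 (trans (x-outside v v∈fT?) Id≡0)))

    x·L-supp : SuppSub (x ·L_) (λ m → D m ≡ true)
    x·L-supp m' x·L≢0 with D m' in m'-decoded?
    ... | true = refl
    ... | false = ⊥-elim (x·L≢0 (begin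
      x ·L m'
        ≡⟨ ∑V-cong (λ v → distribʳ (L v m') (Id v w) (∑M (λ m → correction m (D m) refl v))) ⟩
      ∑V (λ v → Id v w * L v m' + ∑M (λ m → correction m (D m) refl v) * L v m')
        ≡⟨ ∑-distrib-+ n _ _ ⟩
      ∑V (λ v → Id v w * L v m') + (λ v → ∑M (λ m → correction m (D m) refl v)) ·L m'
        ≡⟨ cong₂ _+_ (∑V-Id* (λ v → L v m') w) (·L-∑M (λ m → correction m (D m) refl) m') ⟩
      L w m' + ∑M (λ m → correction m (D m) refl ·L m')
        ≡⟨ cong (L w m' +_) (∑M-single _ m' (λ m m≢m' → correction·L-other m (D m) refl m' (m≢m' ∘ sym) m'-decoded?)) ⟩
      L w m' + correction m' (D m') refl ·L m'
        ≡⟨ cong (L w m' +_) (correction·L-self m' (D m') refl m'-decoded?) ⟩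
      L w m' + - L w m'
        ≡⟨ -‿inverseʳ _ ⟩
      0#
        ∎))

  clear-undecoded : ∀ D → Decoders D → ∀ w → fTall w ≡ false →
    Σ[ x ∈ (V → Carrier) ] (x w ≢ 0# × (∀ v → x v ≢ 0# → (v ≡ w) ⊎ (fTall v ≡ true)) × SuppSub (x ·L_) (λ m → D m ≡ true))
  clear-undecoded D decoders w w∉fT = x , x-w≢0 , x-supp , x·L-supp
    where open ClearUndecoded D decoders w w∉fT

  CliqueCertificate : Set
  CliqueCertificate = Σ[ K ∈ (V → V → Bool) ]
    ((∀ v → IsClique (λ u → K v u ≡ true)) × (∀ v u → K v u ≡ true → Nbh π v u) ×
     Codes.CodingCondition F N C (λ v u → K v u ≡ true))

  LᵀI-column : ∀ (M : V → Bool) m (c : Σ[ w ∈ V ] M w ≡ true) → LᵀI C M m c ≡ L (proj₁ c) m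
  LᵀI-column M m (w , _) = ∑V-*Id (λ v → L v m) w

  RankAtLeast⇒independent-rows : ∀ (M : V → Bool) ρ → RankAtLeast (LᵀI C M) ρ →
    Σ[ row ∈ (Fin ρ → V) ] ((∀ t → M (row t) ≡ true) × Independent (L ∘ row))
  RankAtLeast⇒independent-rows M ρ (col , independent) =
    proj₁ ∘ col , proj₂ ∘ col , Independent-resp (λ t m → LᵀI-column M m (col t)) independent

  -- Rows outside M are replaced by zero rows, which an independent subfamily never selects.
  spanned-by-rows⇒RankAtLeast : ∀ (M : V → Bool) {ρ N'} (row : Fin N' → V)
    (α : Fin ρ → Fin N' → Carrier) (w : Fin ρ → Msg r → Carrier) →
    (∀ t s → α t s ≢ 0# → M (row s) ≡ true) → Spans (L ∘ row) α w → Independent w →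
    RankAtLeast (LᵀI C M) ρ
  spanned-by-rows⇒RankAtLeast M {ρ} {N'} row α w α-supp span independent =
    (λ t → row (col t) , col∈M t) ,
    Independent-resp (λ t m → trans (rowᴹ-col t m) (sym (LᵀI-column M m (row (col t) , col∈M t)))) independent-col
    where
    rowᴹ : Fin N' → Msg r → Carrier
    rowᴹ s m = if M (row s) then L (row s) m else 0#

    spanᴹ : Spans rowᴹ α w
    spanᴹ t m = trans (span t m) (∑-cong N' coefficient≡)
      where
      coefficient≡ : ∀ s → α t s * L (row s) m ≡ α t s * rowᴹ s m
      coefficient≡ s with M (row s) in s∈M?
      ... | true = refl
      ... | false with α t s ≟ 0#
      ...   | yes α≡0 = trans (cong (_* L (row s) m) α≡0) (trans (zeroˡ _) (sym (zeroʳ _)))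
      ...   | no α≢0 = case trans (sym (α-supp t s α≢0)) s∈M? of λ ()

    selected = independent-subfamily N' rowᴹ α w spanᴹ independent
    col = proj₁ selected
    independent-col = proj₂ selected

    col∈M : ∀ t → M (row (col t)) ≡ true
    col∈M t with M (row (col t)) in t∈M?
    ... | true = refl
    ... | false = ⊥-elim (Independent⇒≢0 independent-col t (λ m → cong (λ b → if b then L (row (col t)) m else 0#) t∈M?))

    rowᴹ-col : ∀ t m → rowᴹ (col t) m ≡ L (row (col t)) m
    rowᴹ-col t m rewrite col∈M t = refl

module Product (F : FiniteField) (N₁ N₂ : Instance) (C₁ : Codes.Code F N₁) (C₂ : Codes.Code F N₂) where

  open FieldProperties F
  open Instance N₁ using () renaming (V to V₁; n to n₁; k to k₁; adj to adj₁)
  open Instance N₂ using () renaming (V to V₂; n to n₂; k to k₂; adj to adj₂)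
  open Codes.Code C₁ using () renaming (r to r₁; π to π₁; L to L₁)
  open Codes.Code C₂ using () renaming (r to r₂; π to π₂; L to L₂)
  open ProductCode F N₁ N₂ C₁ C₂ using (Id₁; Id₂; rSplit; entry; prodR; prodL)
  module V₁ = Vertices F N₁
  module V₂ = Vertices F N₂
  module Code₁ = CodeProperties F N₁ C₁
  module Code₂ = CodeProperties F N₂ C₂
  open ≡-Reasoning

  P : Instance
  P = N₁ ⊠ N₂

  π : (V₁ × V₂) ↔ Fin (n₁ ℕ.* n₂)
  π = ↔-sym FinP.*↔× ↔-∘ (π₁ ×-↔ π₂)

  C : Codes.Code F P
  C = ProductCode.prodCode F N₁ N₂ C₁ C₂ π

  module VP = Vertices F P
  module CodeP = CodeProperties F P C

  Msg₁ = Codes.Msg F N₁ r₁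
  Msg₂ = Codes.Msg F N₂ r₂
  MsgP = Codes.Msg F P prodR

  ⊠-adj : ∀ {u u' v v'} → (u' ≡ u ⊎ adj₁ u' u ≡ true) → (v' ≡ v ⊎ adj₂ v' v ≡ true) →
    ¬ (u' ≡ u × v' ≡ v) → Instance.adj P (u' , v') (u , v) ≡ true
  ⊠-adj (inj₁ refl) (inj₁ refl) ≢ = ⊥-elim (≢ (refl , refl))
  ⊠-adj {u} (inj₁ refl) (inj₂ v'v) _ rewrite Instance.eqV-refl N₁ u | V₂.eqV-complete (V₂.adj⇒≢ v'v) | v'v = refl
  ⊠-adj (inj₂ u'u) v'∼v _ rewrite V₁.eqV-complete (V₁.adj⇒≢ u'u) | u'u = second v'∼v
    where
    second : ∀ {v v'} → (v' ≡ v ⊎ adj₂ v' v ≡ true) → (Instance.eqV N₂ v' v ∨ adj₂ v' v) ≡ true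
    second {v} (inj₁ refl) rewrite Instance.eqV-refl N₂ v = refl
    second {v} {v'} (inj₂ v'v) rewrite v'v = ∨-zeroʳ (Instance.eqV N₂ v' v)

  ⊠-Nbh : ∀ {u u' v v'} → Instance.Nbh N₁ π₁ u u' → Instance.Nbh N₂ π₂ v v' →
    Instance.Nbh P π (u , v) (u' , v')
  ⊠-Nbh (inj₁ refl) (inj₁ refl) = inj₁ refl
  ⊠-Nbh {u} {_} {v} {v'} (inj₁ refl) (inj₂ (v'<v , v'v)) =
    inj₂ (earlier , ⊠-adj (inj₁ refl) (inj₂ v'v) (λ (_ , v'≡v) → V₂.adj⇒≢ v'v v'≡v))
    where
    earlier : toℕ (combine (Inverse.to π₁ u) (Inverse.to π₂ v')) ℕ.< toℕ (combine (Inverse.to π₁ u) (Inverse.to π₂ v))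
    earlier rewrite FinP.toℕ-combine (Inverse.to π₁ u) (Inverse.to π₂ v')
                  | FinP.toℕ-combine (Inverse.to π₁ u) (Inverse.to π₂ v) = ℕP.+-monoʳ-< _ v'<v
  ⊠-Nbh {v = v} {v'} (inj₂ (u'<u , u'u)) v∼v' =
    inj₂ (FinP.combine-monoˡ-< (Inverse.to π₂ v') (Inverse.to π₂ v) u'<u ,
          ⊠-adj (inj₂ u'u) (forget-order v∼v') (λ (u'≡u , _) → V₁.adj⇒≢ u'u u'≡u))
    where
    forget-order : Instance.Nbh N₂ π₂ v v' → (v' ≡ v ⊎ adj₂ v' v ≡ true)
    forget-order (inj₁ v'≡v) = inj₁ v'≡v
    forget-order (inj₂ (_ , v'v)) = inj₂ v'v

  data SplitView : Fin (k₁ ℕ.+ k₂) → Set where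
    left  : ∀ i₁ → SplitView (i₁ ↑ˡ k₂)
    right : ∀ i₂ → SplitView (k₁ ↑ʳ i₂)

  splitView : ∀ i → SplitView i
  splitView i with splitAt k₁ i in split≡
  ... | inj₁ i₁ = subst SplitView (FinP.splitAt⁻¹-↑ˡ split≡) (left i₁)
  ... | inj₂ i₂ = subst SplitView (FinP.splitAt⁻¹-↑ʳ split≡) (right i₂)

  cast : ∀ {x y} → x ≡ y → Fin (rSplit x) → Fin (rSplit y)
  cast = subst (Fin ∘ rSplit)

  cast-elim : ∀ {b} {B : Set b} (f : ∀ x → Fin (rSplit x) → B) {x y} (x≡y : x ≡ y) j →
    f y (cast x≡y j) ≡ f x j
  cast-elim f refl j = refl

  -- msg₁ (s , a) v is the column ((s , a) , v) of L₁ ⊗ I, and msg₂ (s , a) u the column (u , (s , a)) of I ⊗ L₂.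
  msg₁ : Msg₁ → V₂ → MsgP
  msg₁ (i₁ , a) v = i₁ ↑ˡ k₂ , cast (sym (splitAt-↑ˡ k₁ i₁ k₂)) (combine a (V₂.from v))

  msg₂ : Msg₂ → V₁ → MsgP
  msg₂ (i₂ , a) u = k₁ ↑ʳ i₂ , cast (sym (splitAt-↑ʳ k₁ k₂ i₂)) (combine a (V₁.from u))

  data MsgView : MsgP → Set where
    msg₁-view : ∀ m v → MsgView (msg₁ m v)
    msg₂-view : ∀ m u → MsgView (msg₂ m u)

  msgView : ∀ m → MsgView m
  msgView (i , j) with splitView i
  ... | left i₁ = subst MsgView (cong (i₁ ↑ˡ k₂ ,_) (begin
      cast (sym e) (combine a (V₂.from (V₂.to b)))   ≡⟨ cong (cast (sym e) ∘ combine a) (V₂.from-to b) ⟩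
      cast (sym e) (combine a b)                     ≡⟨ cong (cast (sym e)) (FinP.combine-remQuot {r₁ i₁} n₂ (cast e j)) ⟩
      cast (sym e) (cast e j)                        ≡⟨ subst-sym-subst e ⟩
      j                                              ∎))
    (msg₁-view (i₁ , a) (V₂.to b))
    where
    e = splitAt-↑ˡ k₁ i₁ k₂
    a = proj₁ (remQuot {r₁ i₁} n₂ (cast e j))
    b = proj₂ (remQuot {r₁ i₁} n₂ (cast e j))
  ... | right i₂ = subst MsgView (cong (k₁ ↑ʳ i₂ ,_) (begin
      cast (sym e) (combine a (V₁.from (V₁.to b)))   ≡⟨ cong (cast (sym e) ∘ combine a) (V₁.from-to b) ⟩
      cast (sym e) (combine a b)                     ≡⟨ cong (cast (sym e)) (FinP.combine-remQuot {r₂ i₂} n₁ (cast e j)) ⟩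
      cast (sym e) (cast e j)                        ≡⟨ subst-sym-subst e ⟩
      j                                              ∎))
    (msg₂-view (i₂ , a) (V₁.to b))
    where
    e = splitAt-↑ʳ k₁ k₂ i₂
    a = proj₁ (remQuot {r₂ i₂} n₁ (cast e j))
    b = proj₂ (remQuot {r₂ i₂} n₁ (cast e j))

  prodL-msg₁ : ∀ p m v → prodL p (msg₁ m v) ≡ L₁ (proj₁ p) m * Id₂ (proj₂ p) v
  prodL-msg₁ p (i₁ , a) v = begin
    entry (splitAt k₁ (i₁ ↑ˡ k₂)) (cast (sym (splitAt-↑ˡ k₁ i₁ k₂)) (combine a (V₂.from v))) p
      ≡⟨ cast-elim (λ x j → entry x j p) (sym (splitAt-↑ˡ k₁ i₁ k₂)) _ ⟩
    L₁ (proj₁ p) (i₁ , proj₁ (remQuot {r₁ i₁} n₂ (combine a (V₂.from v)))) * Id₂ (proj₂ p) (V₂.to (proj₂ (remQuot {r₁ i₁} n₂ (combine a (V₂.from v)))))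
      ≡⟨ cong (λ (a' , b) → L₁ (proj₁ p) (i₁ , a') * Id₂ (proj₂ p) (V₂.to b)) (FinP.remQuot-combine {r₁ i₁} {n₂} a (V₂.from v)) ⟩
    L₁ (proj₁ p) (i₁ , a) * Id₂ (proj₂ p) (V₂.to (V₂.from v))
      ≡⟨ cong (λ v' → L₁ (proj₁ p) (i₁ , a) * Id₂ (proj₂ p) v') (V₂.to-from v) ⟩
    L₁ (proj₁ p) (i₁ , a) * Id₂ (proj₂ p) v
      ∎

  prodL-msg₂ : ∀ p m u → prodL p (msg₂ m u) ≡ Id₁ (proj₁ p) u * L₂ (proj₂ p) m
  prodL-msg₂ p (i₂ , a) u = begin
    entry (splitAt k₁ (k₁ ↑ʳ i₂)) (cast (sym (splitAt-↑ʳ k₁ k₂ i₂)) (combine a (V₁.from u))) p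
      ≡⟨ cast-elim (λ x j → entry x j p) (sym (splitAt-↑ʳ k₁ k₂ i₂)) _ ⟩
    Id₁ (proj₁ p) (V₁.to (proj₂ (remQuot {r₂ i₂} n₁ (combine a (V₁.from u))))) * L₂ (proj₂ p) (i₂ , proj₁ (remQuot {r₂ i₂} n₁ (combine a (V₁.from u))))
      ≡⟨ cong (λ (a' , b) → Id₁ (proj₁ p) (V₁.to b) * L₂ (proj₂ p) (i₂ , a')) (FinP.remQuot-combine {r₂ i₂} {n₁} a (V₁.from u)) ⟩
    Id₁ (proj₁ p) (V₁.to (V₁.from u)) * L₂ (proj₂ p) (i₂ , a)
      ≡⟨ cong (λ u' → Id₁ (proj₁ p) u' * L₂ (proj₂ p) (i₂ , a)) (V₁.to-from u) ⟩
    Id₁ (proj₁ p) u * L₂ (proj₂ p) (i₂ , a)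
      ∎

  fS-↑ˡ : ∀ i₁ p → Instance.fS P (i₁ ↑ˡ k₂) p ≡ Instance.fS N₁ i₁ (proj₁ p)
  fS-↑ˡ i₁ p = cong [ (λ i → Instance.fS N₁ i (proj₁ p)) , (λ i → Instance.fS N₂ i (proj₂ p)) ]′ (splitAt-↑ˡ k₁ i₁ k₂)

  fS-↑ʳ : ∀ i₂ p → Instance.fS P (k₁ ↑ʳ i₂) p ≡ Instance.fS N₂ i₂ (proj₂ p)
  fS-↑ʳ i₂ p = cong [ (λ i → Instance.fS N₁ i (proj₁ p)) , (λ i → Instance.fS N₂ i (proj₂ p)) ]′ (splitAt-↑ʳ k₁ k₂ i₂)

  fT-↑ˡ : ∀ i₁ p → Instance.fT P (i₁ ↑ˡ k₂) p ≡ Instance.fT N₁ i₁ (proj₁ p)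
  fT-↑ˡ i₁ p = cong [ (λ i → Instance.fT N₁ i (proj₁ p)) , (λ i → Instance.fT N₂ i (proj₂ p)) ]′ (splitAt-↑ˡ k₁ i₁ k₂)

  fT-↑ʳ : ∀ i₂ p → Instance.fT P (k₁ ↑ʳ i₂) p ≡ Instance.fT N₂ i₂ (proj₂ p)
  fT-↑ʳ i₂ p = cong [ (λ i → Instance.fT N₁ i (proj₁ p)) , (λ i → Instance.fT N₂ i (proj₂ p)) ]′ (splitAt-↑ʳ k₁ k₂ i₂)

  infixl 7 _⊗_
  _⊗_ : (V₁ → Carrier) → (V₂ → Carrier) → V₁ × V₂ → Carrier
  (a₁ ⊗ a₂) p = a₁ (proj₁ p) * a₂ (proj₂ p)

  ∑V-⊗ : ∀ (a₁ b₁ : V₁ → Carrier) (a₂ b₂ : V₂ → Carrier) →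
    VP.∑V (λ p → (a₁ ⊗ a₂) p * (b₁ ⊗ b₂) p) ≡ V₁.∑V (λ u → a₁ u * b₁ u) * V₂.∑V (λ v → a₂ v * b₂ v)
  ∑V-⊗ a₁ b₁ a₂ b₂ = begin
    VP.∑V (λ p → (a₁ ⊗ a₂) p * (b₁ ⊗ b₂) p)
      ≡⟨ ∑-remQuot n₁ n₂ (λ i j → (a₁ ⊗ a₂) (V₁.to i , V₂.to j) * (b₁ ⊗ b₂) (V₁.to i , V₂.to j)) ⟩
    V₁.∑V (λ u → V₂.∑V (λ v → (a₁ u * a₂ v) * (b₁ u * b₂ v)))
      ≡⟨ V₁.∑V-cong (λ u → V₂.∑V-cong (λ v → interchange (a₁ u) (a₂ v) (b₁ u) (b₂ v))) ⟩
    V₁.∑V (λ u → V₂.∑V (λ v → (a₁ u * b₁ u) * (a₂ v * b₂ v)))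
      ≡⟨ V₁.∑V-cong (λ u → *-distribˡ-∑ n₂ (a₁ u * b₁ u) _) ⟨
    V₁.∑V (λ u → (a₁ u * b₁ u) * V₂.∑V (λ v → a₂ v * b₂ v))
      ≡⟨ *-distribʳ-∑ n₁ _ _ ⟨
    V₁.∑V (λ u → a₁ u * b₁ u) * V₂.∑V (λ v → a₂ v * b₂ v)
      ∎

  ⊗·L-msg₁ : ∀ a₁ a₂ m v → (a₁ ⊗ a₂) CodeP.·L msg₁ m v ≡ (a₁ Code₁.·L m) * a₂ v
  ⊗·L-msg₁ a₁ a₂ m v = begin
    (a₁ ⊗ a₂) CodeP.·L msg₁ m v
      ≡⟨ VP.∑V-cong (λ p → cong ((a₁ ⊗ a₂) p *_) (prodL-msg₁ p m v)) ⟩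
    VP.∑V (λ p → (a₁ ⊗ a₂) p * ((λ u → L₁ u m) ⊗ (λ v' → Id₂ v' v)) p)
      ≡⟨ ∑V-⊗ a₁ (λ u → L₁ u m) a₂ (λ v' → Id₂ v' v) ⟩
    (a₁ Code₁.·L m) * V₂.∑V (λ v' → a₂ v' * Id₂ v' v)
      ≡⟨ cong ((a₁ Code₁.·L m) *_) (V₂.∑V-*Id a₂ v) ⟩
    (a₁ Code₁.·L m) * a₂ v
      ∎

  ⊗·L-msg₂ : ∀ a₁ a₂ m u → (a₁ ⊗ a₂) CodeP.·L msg₂ m u ≡ a₁ u * (a₂ Code₂.·L m)
  ⊗·L-msg₂ a₁ a₂ m u = begin
    (a₁ ⊗ a₂) CodeP.·L msg₂ m u
      ≡⟨ VP.∑V-cong (λ p → cong ((a₁ ⊗ a₂) p *_) (prodL-msg₂ p m u)) ⟩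
    VP.∑V (λ p → (a₁ ⊗ a₂) p * ((λ u' → Id₁ u' u) ⊗ (λ v → L₂ v m)) p)
      ≡⟨ ∑V-⊗ a₁ (λ u' → Id₁ u' u) a₂ (λ v → L₂ v m) ⟩
    V₁.∑V (λ u' → a₁ u' * Id₁ u' u) * (a₂ Code₂.·L m)
      ≡⟨ cong (_* (a₂ Code₂.·L m)) (V₁.∑V-*Id a₁ u) ⟩
    a₁ u * (a₂ Code₂.·L m)
      ∎

  ⊗-coding : ∀ {K₁ K₂} → Codes.CodingCondition F N₁ C₁ K₁ → Codes.CodingCondition F N₂ C₂ K₂ →
    Codes.CodingCondition F P C (λ p q → K₁ (proj₁ p) (proj₁ q) × K₂ (proj₂ p) (proj₂ q))
  ⊗-coding coding₁ coding₂ (u , v) with coding₁ u | coding₂ v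
  ... | a₁ , a₁ᵤ≢0 , supp₁ , msgs₁ | a₂ , a₂ᵥ≢0 , supp₂ , msgs₂ =
    a₁ ⊗ a₂ , x*y≢0 a₁ᵤ≢0 a₂ᵥ≢0 ,
    (λ q ≢0 → supp₁ (proj₁ q) (x*y≢0⇒x≢0 ≢0) , supp₂ (proj₂ q) (x*y≢0⇒y≢0 ≢0)) , msgs
    where
    msgs : SuppSub ((a₁ ⊗ a₂) CodeP.·L_) (Codes.MsgAt F P C (u , v))
    msgs m ≢0 with msgView m
    ... | msg₁-view m₁ v' = trans (fS-↑ˡ (proj₁ m₁) (u , v)) (msgs₁ m₁ (x*y≢0⇒x≢0 (≢0 ∘ trans (⊗·L-msg₁ a₁ a₂ m₁ v'))))
    ... | msg₂-view m₂ u' = trans (fS-↑ʳ (proj₁ m₂) (u , v)) (msgs₂ m₂ (x*y≢0⇒y≢0 (≢0 ∘ trans (⊗·L-msg₂ a₁ a₂ m₂ u'))))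

  isLinearNetworkCode : Codes.IsLinearNetworkCode F N₁ C₁ → Codes.IsLinearNetworkCode F N₂ C₂ →
    Codes.IsLinearNetworkCode F P C
  isLinearNetworkCode coding₁ coding₂ p with ⊗-coding coding₁ coding₂ p
  ... | a , aₚ≢0 , supp , msgs = a , aₚ≢0 , (λ q ≢0 → uncurry ⊠-Nbh (supp q ≢0)) , msgs

  module Decoding (D₁ : Msg₁ → Bool) (decoders₁ : Code₁.Decoders D₁)
                  (D₂ : Msg₂ → Bool) (decoders₂ : Code₂.Decoders D₂) where

    open Instance N₂ using () renaming (fTall to fT₂)

    -- Messages of N₁ copied to a vertex of f₂(T) are given up.
    D-split : (x : Fin k₁ ⊎ Fin k₂) → Fin (rSplit x) → Bool
    D-split (inj₁ i₁) j = D₁ (i₁ , proj₁ (remQuot {r₁ i₁} n₂ j)) ∨ fT₂ (V₂.to (proj₂ (remQuot {r₁ i₁} n₂ j)))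
    D-split (inj₂ i₂) j = D₂ (i₂ , proj₁ (remQuot {r₂ i₂} n₁ j))

    D : MsgP → Bool
    D (i , j) = D-split (splitAt k₁ i) j

    D-msg₁ : ∀ m v → D (msg₁ m v) ≡ D₁ m ∨ fT₂ v
    D-msg₁ (i₁ , a) v = begin
      D-split (splitAt k₁ (i₁ ↑ˡ k₂)) (cast (sym (splitAt-↑ˡ k₁ i₁ k₂)) (combine a (V₂.from v)))
        ≡⟨ cast-elim D-split (sym (splitAt-↑ˡ k₁ i₁ k₂)) _ ⟩
      D-split (inj₁ i₁) (combine a (V₂.from v))
        ≡⟨ cong (λ (a' , b) → D₁ (i₁ , a') ∨ fT₂ (V₂.to b)) (FinP.remQuot-combine {r₁ i₁} {n₂} a (V₂.from v)) ⟩
      D₁ (i₁ , a) ∨ fT₂ (V₂.to (V₂.from v))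
        ≡⟨ cong (λ v' → D₁ (i₁ , a) ∨ fT₂ v') (V₂.to-from v) ⟩
      D₁ (i₁ , a) ∨ fT₂ v
        ∎

    D-msg₂ : ∀ m u → D (msg₂ m u) ≡ D₂ m
    D-msg₂ (i₂ , a) u = begin
      D-split (splitAt k₁ (k₁ ↑ʳ i₂)) (cast (sym (splitAt-↑ʳ k₁ k₂ i₂)) (combine a (V₁.from u)))
        ≡⟨ cast-elim D-split (sym (splitAt-↑ʳ k₁ k₂ i₂)) _ ⟩
      D₂ (i₂ , proj₁ (remQuot {r₂ i₂} n₁ (combine a (V₁.from u))))
        ≡⟨ cong (λ (a' , _) → D₂ (i₂ , a')) (FinP.remQuot-combine {r₂ i₂} {n₁} a (V₁.from u)) ⟩
      D₂ (i₂ , a)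
        ∎

    D-msg₁ˡ : ∀ m v → D₁ m ≡ true → D (msg₁ m v) ≡ true
    D-msg₁ˡ m v m-decoded = trans (D-msg₁ m v) (cong (_∨ fT₂ v) m-decoded)

    D-msg₁ʳ : ∀ m v → fT₂ v ≡ true → D (msg₁ m v) ≡ true
    D-msg₁ʳ m v v∈fT = trans (D-msg₁ m v) (trans (cong (D₁ m ∨_) v∈fT) (∨-zeroʳ (D₁ m)))

    Decoder : MsgP → Set
    Decoder m = Σ[ d ∈ (V₁ × V₂ → Carrier) ]
      (SuppSub d (λ p → Instance.fT P (proj₁ m) p ≡ true) ×
       InSupp (d CodeP.·L_) m × SuppSub (d CodeP.·L_) (λ m' → (m' ≡ m) ⊎ (D m' ≡ true)))

    -- d₁ ⊗ x, where d₁ decodes m in N₁ and x is row v of L₂ cleared of the messages undecoded in N₂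
    decoder-msg₁ : ∀ m v → D₁ m ≡ false → fT₂ v ≡ false → Decoder (msg₁ m v)
    decoder-msg₁ m v m-undecoded v∉fT with decoders₁ m m-undecoded | Code₂.clear-undecoded D₂ decoders₂ v v∉fT
    ... | d₁ , supp₁ , d₁·L≢0 , others₁ | x , xᵥ≢0 , x-supp , x·L-supp =
      d₁ ⊗ x ,
      (λ p ≢0 → trans (fT-↑ˡ (proj₁ m) p) (supp₁ (proj₁ p) (x*y≢0⇒x≢0 ≢0))) ,
      x*y≢0 d₁·L≢0 xᵥ≢0 ∘ trans (sym (⊗·L-msg₁ d₁ x m v)) ,
      others
      where
      others : SuppSub ((d₁ ⊗ x) CodeP.·L_) (λ m' → (m' ≡ msg₁ m v) ⊎ (D m' ≡ true))
      others m' ≢0 with msgView m'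
      ... | msg₂-view m₂ u = inj₂ (trans (D-msg₂ m₂ u) (x·L-supp m₂ (x*y≢0⇒y≢0 (≢0 ∘ trans (⊗·L-msg₂ d₁ x m₂ u)))))
      ... | msg₁-view m₁ v' with others₁ m₁ (x*y≢0⇒x≢0 (≢0 ∘ trans (⊗·L-msg₁ d₁ x m₁ v')))
                               | x-supp v' (x*y≢0⇒y≢0 (≢0 ∘ trans (⊗·L-msg₁ d₁ x m₁ v')))
      ...   | inj₂ m₁-decoded | _ = inj₂ (D-msg₁ˡ m₁ v' m₁-decoded)
      ...   | inj₁ _ | inj₂ v'∈fT = inj₂ (D-msg₁ʳ m₁ v' v'∈fT)
      ...   | inj₁ m₁≡m | inj₁ v'≡v = inj₁ (cong₂ msg₁ m₁≡m v'≡v)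

    decoder-msg₂ : ∀ m u → D₂ m ≡ false → Decoder (msg₂ m u)
    decoder-msg₂ m u m-undecoded with decoders₂ m m-undecoded
    ... | d₂ , supp₂ , d₂·L≢0 , others₂ =
      eᵤ ⊗ d₂ ,
      (λ p ≢0 → trans (fT-↑ʳ (proj₁ m) p) (supp₂ (proj₂ p) (x*y≢0⇒y≢0 ≢0))) ,
      x*y≢0 (λ eᵤᵤ≡0 → 1≢0 (trans (sym (V₁.Id-refl u)) eᵤᵤ≡0)) d₂·L≢0 ∘ trans (sym (⊗·L-msg₂ eᵤ d₂ m u)) ,
      others
      where
      eᵤ : V₁ → Carrier
      eᵤ u' = V₁.Id u' u
      others : SuppSub ((eᵤ ⊗ d₂) CodeP.·L_) (λ m' → (m' ≡ msg₂ m u) ⊎ (D m' ≡ true))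
      others m' ≢0 with msgView m'
      ... | msg₁-view m₁ v = inj₂ (D-msg₁ʳ m₁ v (V₂.fT⇒fTall (proj₁ m) v
              (supp₂ v (x*y≢0⇒y≢0 (≢0 ∘ trans (⊗·L-msg₁ eᵤ d₂ m₁ v))))))
      ... | msg₂-view m₂ u' with others₂ m₂ (x*y≢0⇒y≢0 (≢0 ∘ trans (⊗·L-msg₂ eᵤ d₂ m₂ u')))
      ...   | inj₂ m₂-decoded = inj₂ (trans (D-msg₂ m₂ u') m₂-decoded)
      ...   | inj₁ m₂≡m = inj₁ (cong₂ msg₂ m₂≡m (V₁.Id≢0⇒≡ (x*y≢0⇒x≢0 (≢0 ∘ trans (⊗·L-msg₂ eᵤ d₂ m₂ u')))))

    decoders : CodeP.Decoders D
    decoders m m-undecoded with msgView m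
    ... | msg₁-view m₁ v = decoder-msg₁ m₁ v
            (∨-conicalˡ _ _ (trans (sym (D-msg₁ m₁ v)) m-undecoded))
            (∨-conicalʳ _ _ (trans (sym (D-msg₁ m₁ v)) m-undecoded))
    ... | msg₂-view m₂ u = decoder-msg₂ m₂ u (trans (sym (D-msg₂ m₂ u)) m-undecoded)

    open Counting using (indicator; ∑∑)

    T = Instance.card N₂ fT₂
    decoded₁ = Codes.cardMsgs F N₁ C₁ D₁
    undecoded₁ = ∑∑ k₁ r₁ (indicator ∘ not ∘ D₁)
    decoded₂ = Codes.cardMsgs F N₂ C₂ D₂

    count-vertices : ∀ b → sumℕ n₂ (λ w → indicator (b ∨ fT₂ (V₂.to w))) ≡ n₂ ℕ.* indicator b ℕ.+ T ℕ.* indicator (not b)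
    count-vertices true = trans (Counting.∑-const n₂ 1) (sym (trans (cong (n₂ ℕ.* 1 ℕ.+_) (ℕP.*-zeroʳ T)) (ℕP.+-identityʳ _)))
    count-vertices false = sym (cong₂ ℕ._+_ (ℕP.*-zeroʳ n₂) (ℕP.*-identityʳ T))

    decoded : Codes.cardMsgs F P C D ≡ (n₂ ℕ.* decoded₁ ℕ.+ T ℕ.* undecoded₁) ℕ.+ n₁ ℕ.* decoded₂
    decoded = begin
      Codes.cardMsgs F P C D
        ≡⟨ Counting.∑-splitAt k₁ (λ x → sumℕ (rSplit x) (indicator ∘ D-split x)) ⟩
      sumℕ k₁ (λ i₁ → sumℕ (r₁ i₁ ℕ.* n₂) (indicator ∘ D-split (inj₁ i₁))) ℕ.+ sumℕ k₂ (λ i₂ → sumℕ (r₂ i₂ ℕ.* n₁) (indicator ∘ D-split (inj₂ i₂)))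
        ≡⟨ cong₂ ℕ._+_
             (Counting.∑-cong k₁ λ i₁ → trans (Counting.∑-remQuot (r₁ i₁) n₂ (λ a w → indicator (D₁ (i₁ , a) ∨ fT₂ (V₂.to w))))
                                       (Counting.∑-cong (r₁ i₁) (λ a → count-vertices (D₁ (i₁ , a)))))
             (Counting.∑-cong k₂ λ i₂ → trans (Counting.∑-remQuot (r₂ i₂) n₁ (λ a _ → indicator (D₂ (i₂ , a))))
                                       (Counting.∑-cong (r₂ i₂) (λ a → Counting.∑-const n₁ _))) ⟩
      ∑∑ k₁ r₁ (λ m → n₂ ℕ.* indicator (D₁ m) ℕ.+ T ℕ.* indicator (not (D₁ m))) ℕ.+ ∑∑ k₂ r₂ (λ m → n₁ ℕ.* indicator (D₂ m))
        ≡⟨ cong₂ ℕ._+_ (trans (Counting.∑∑-distrib-+ k₁ r₁ _ _) (sym (cong₂ ℕ._+_ (Counting.*-distribˡ-∑∑ k₁ r₁ n₂ _) (Counting.*-distribˡ-∑∑ k₁ r₁ T _))))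
                     (sym (Counting.*-distribˡ-∑∑ k₂ r₂ n₁ _)) ⟩
      (n₂ ℕ.* decoded₁ ℕ.+ T ℕ.* undecoded₁) ℕ.+ n₁ ℕ.* decoded₂
        ∎

    decoded₁+undecoded₁ : decoded₁ ℕ.+ undecoded₁ ≡ Codes.numMsgs F N₁ C₁
    decoded₁+undecoded₁ = Counting.∑∑-indicator+∑∑-indicator-not k₁ r₁ D₁

  numMsgs : Codes.numMsgs F P C ≡ Codes.numMsgs F N₁ C₁ ℕ.* n₂ ℕ.+ Codes.numMsgs F N₂ C₂ ℕ.* n₁
  numMsgs = trans (Counting.∑-splitAt k₁ rSplit)
    (sym (cong₂ ℕ._+_ (Counting.*-distribʳ-∑ k₁ n₂ r₁) (Counting.*-distribʳ-∑ k₂ n₁ r₂)))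

  decodable : ∀ p₁ p₂ → Codes.Decodable F N₁ C₁ p₁ → Codes.Decodable F N₂ C₂ p₂ →
    Codes.Decodable F P C (n₁ ℕ.* p₂ ℕ.+ n₂ ℕ.* p₁ ℕ.∸ p₁ ℕ.* Instance.card N₂ (Instance.fTall N₂))
  decodable p₁ p₂ (D₁ , count₁ , decoders₁) (D₂ , count₂ , decoders₂) = D , count , decoders
    where
    open Decoding D₁ decoders₁ D₂ decoders₂
    undecoded₁≡p₁ : undecoded₁ ≡ p₁
    undecoded₁≡p₁ = ℕP.+-cancelˡ-≡ decoded₁ undecoded₁ p₁ (trans decoded₁+undecoded₁ (sym count₁))
    count : Codes.cardMsgs F P C D ℕ.+ (n₁ ℕ.* p₂ ℕ.+ n₂ ℕ.* p₁ ℕ.∸ p₁ ℕ.* T) ≡ Codes.numMsgs F P C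
    count = begin
      Codes.cardMsgs F P C D ℕ.+ (n₁ ℕ.* p₂ ℕ.+ n₂ ℕ.* p₁ ℕ.∸ p₁ ℕ.* T)
        ≡⟨ cong (ℕ._+ (n₁ ℕ.* p₂ ℕ.+ n₂ ℕ.* p₁ ℕ.∸ p₁ ℕ.* T)) (trans decoded (cong (λ e → n₂ ℕ.* decoded₁ ℕ.+ T ℕ.* e ℕ.+ n₁ ℕ.* decoded₂) undecoded₁≡p₁)) ⟩
      (n₂ ℕ.* decoded₁ ℕ.+ T ℕ.* p₁ ℕ.+ n₁ ℕ.* decoded₂) ℕ.+ (n₁ ℕ.* p₂ ℕ.+ n₂ ℕ.* p₁ ℕ.∸ p₁ ℕ.* T)
        ≡⟨ Counting.product-rate-arithmetic n₁ n₂ decoded₁ decoded₂ p₁ p₂ T (Counting.∑-indicator≤ n₂ (Instance.fTall N₂ ∘ V₂.to)) ⟩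
      (decoded₁ ℕ.+ p₁) ℕ.* n₂ ℕ.+ (decoded₂ ℕ.+ p₂) ℕ.* n₁
        ≡⟨ cong₂ (λ a b → a ℕ.* n₂ ℕ.+ b ℕ.* n₁) count₁ count₂ ⟩
      Codes.numMsgs F N₁ C₁ ℕ.* n₂ ℕ.+ Codes.numMsgs F N₂ C₂ ℕ.* n₁
        ≡⟨ numMsgs ⟨
      Codes.numMsgs F P C
        ∎

  ⊠-cliqueCertificate : Code₁.CliqueCertificate → Code₂.CliqueCertificate → CodeP.CliqueCertificate
  ⊠-cliqueCertificate (K₁ , cliques₁ , K₁⊆Nbh , coding₁) (K₂ , cliques₂ , K₂⊆Nbh , coding₂) =
    K , cliques , (λ p q pKq → ⊠-Nbh (K₁⊆Nbh _ _ (proj₁ (both pKq))) (K₂⊆Nbh _ _ (proj₂ (both pKq)))) , codingK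
    where
    K : V₁ × V₂ → V₁ × V₂ → Bool
    K p q = K₁ (proj₁ p) (proj₁ q) ∧ K₂ (proj₂ p) (proj₂ q)

    both : ∀ {p q} → K p q ≡ true → K₁ (proj₁ p) (proj₁ q) ≡ true × K₂ (proj₂ p) (proj₂ q) ≡ true
    both pKq = ∧-conicalˡ _ _ pKq , ∧-conicalʳ _ _ pKq

    cliques : ∀ p → Instance.IsClique P (λ q → K p q ≡ true)
    cliques (u , v) (x , y) (x' , y') pKq pKq' q≢q' = ⊠-adj adjacent₁ adjacent₂ (λ (x≡x' , y≡y') → q≢q' (cong₂ _,_ x≡x' y≡y'))
      where
      adjacent₁ : (x ≡ x') ⊎ (adj₁ x x' ≡ true)
      adjacent₁ with V₁.≡-or-≢ x x'
      ... | inj₁ x≡x' = inj₁ x≡x'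
      ... | inj₂ x≢x' = inj₂ (cliques₁ u x x' (proj₁ (both pKq)) (proj₁ (both pKq')) x≢x')
      adjacent₂ : (y ≡ y') ⊎ (adj₂ y y' ≡ true)
      adjacent₂ with V₂.≡-or-≢ y y'
      ... | inj₁ y≡y' = inj₁ y≡y'
      ... | inj₂ y≢y' = inj₂ (cliques₂ v y y' (proj₂ (both pKq)) (proj₂ (both pKq')) y≢y')

    codingK : Codes.CodingCondition F P C (λ p q → K p q ≡ true)
    codingK p with ⊗-coding coding₁ coding₂ p
    ... | a , aₚ≢0 , supp , msgs = a , aₚ≢0 , (λ q ≢0 → uncurry ∧-intro (supp q ≢0)) , msgs
      where
      ∧-intro : ∀ {a b} → a ≡ true → b ≡ true → a ∧ b ≡ true
      ∧-intro refl refl = refl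

  module _ {M : V₁ × V₂ → Bool} (multicut : Instance.Multicut P M) where

    private
      lift-slice : ∀ u {y y'} → Instance.PathAvoid N₂ (λ z → M (u , z)) y y' → Instance.PathAvoid P M (u , y) (u , y')
      lift-slice u (Instance.here y∉M) = Instance.here y∉M
      lift-slice u (Instance.step y∉M yy' path) =
        Instance.step y∉M (⊠-adj (inj₁ refl) (inj₂ yy') (λ (_ , y≡y') → V₂.adj⇒≢ yy' y≡y')) (lift-slice u path)

    slice-multicut : ∀ u → Instance.Multicut N₂ (λ y → M (u , y))
    slice-multicut u i₂ (y₀ , y₁ , s , t , path) =
      multicut (k₁ ↑ʳ i₂) ((u , y₀) , (u , y₁) , trans (fS-↑ʳ i₂ _) s , trans (fT-↑ʳ i₂ _) t , lift-slice u path)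

    module _ (K : V₂ → Bool) (clique : Instance.IsClique N₂ (λ y → K y ≡ true)) where

      covers? : ∀ x y → Dec (K y ≡ true → M (x , y) ≡ true)
      covers? x y = (K y Bool.≟ true) →-dec (M (x , y) Bool.≟ true)

      covering : V₁ → Bool
      covering x = does (V₂.all? (covers? x))

      covering-true : ∀ {x} → covering x ≡ true → ∀ y → K y ≡ true → M (x , y) ≡ true
      covering-true {x} = dec-true⁻¹ (V₂.all? (covers? x))

      private
        uncovered-witness : ∀ {x} → covering x ≡ false → ∃[ y ] (K y ≡ true × M (x , y) ≡ false)
        uncovered-witness {x} uncovered with V₂.¬∀⇒∃¬ (covers? x) (dec-false⁻¹ (V₂.all? (covers? x)) uncovered)
        ... | y , ¬covered with K y in y∈K? | M (x , y) in xy∈M?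
        ...   | true | true = ⊥-elim (¬covered (λ _ → refl))
        ...   | true | false = y , y∈K? , xy∈M?
        ...   | false | _ = ⊥-elim (¬covered (λ ()))

        lift-covering : ∀ {x x'} → Instance.PathAvoid N₁ covering x x' →
          ∃₂ λ y y' → K y ≡ true × Instance.PathAvoid P M (x , y) (x' , y')
        lift-covering (Instance.here uncovered) with uncovered-witness uncovered
        ... | y , y∈K , y∉M = y , y , y∈K , Instance.here y∉M
        lift-covering (Instance.step uncovered xx₂ path) with uncovered-witness uncovered | lift-covering path
        ... | y , y∈K , xy∉M | y₂ , y' , y₂∈K , path' =
          y , y' , y∈K , Instance.step xy∉M (⊠-adj (inj₂ xx₂) y∼y₂ (λ (x≡x₂ , _) → V₁.adj⇒≢ xx₂ x≡x₂)) path'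
          where
          y∼y₂ : (y ≡ y₂) ⊎ (adj₂ y y₂ ≡ true)
          y∼y₂ with V₂.≡-or-≢ y y₂
          ... | inj₁ y≡y₂ = inj₁ y≡y₂
          ... | inj₂ y≢y₂ = inj₂ (clique y y₂ y∈K y₂∈K y≢y₂)

      covering-multicut : Instance.Multicut N₁ covering
      covering-multicut i₁ (x₀ , x₁ , s , t , path) with lift-covering path
      ... | y₀ , y₁ , _ , path' = multicut (i₁ ↑ˡ k₂) ((x₀ , y₀) , (x₁ , y₁) , trans (fS-↑ˡ i₁ _) s , trans (fT-↑ˡ i₁ _) t , path')

  module Certification (ρ₁ ρ₂ : ℕ)
    (rank₁ : ∀ M₁ → Instance.Multicut N₁ M₁ → RankAtLeast (Codes.LᵀI F N₁ C₁ M₁) ρ₁)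
    (rank₂ : ∀ M₂ → Instance.Multicut N₂ M₂ → RankAtLeast (Codes.LᵀI F N₂ C₂ M₂) ρ₂)
    (K₂ : V₂ → V₂ → Bool) (cliques₂ : ∀ v → Instance.IsClique N₂ (λ u → K₂ v u ≡ true))
    (K₂⊆Nbh : ∀ v u → K₂ v u ≡ true → Instance.Nbh N₂ π₂ v u)
    (coding₂ : Codes.CodingCondition F N₂ C₂ (λ v u → K₂ v u ≡ true))
    {M : V₁ × V₂ → Bool} (multicut : Instance.Multicut P M) where

    open Instance N₂ using () renaming (fSall to fS₂)

    rowsA : ∀ u → Σ[ row ∈ (Fin ρ₂ → V₂) ] ((∀ t → M (u , row t) ≡ true) × Code₂.Independent (L₂ ∘ row))
    rowsA u = Code₂.RankAtLeast⇒independent-rows _ ρ₂ (rank₂ _ (slice-multicut multicut u))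

    rowA : V₁ → Fin ρ₂ → V₂
    rowA u = proj₁ (rowsA u)

    rowsB : ∀ v → Σ[ row ∈ (Fin ρ₁ → V₁) ] ((∀ t → covering multicut (K₂ v) (cliques₂ v) (row t) ≡ true) ×
                                             Code₁.Independent (L₁ ∘ row))
    rowsB v = Code₁.RankAtLeast⇒independent-rows _ ρ₁ (rank₁ _ (covering-multicut multicut (K₂ v) (cliques₂ v)))

    rowB : V₂ → Fin ρ₁ → V₁
    rowB v = proj₁ (rowsB v)

    rowB∈M : ∀ v t y → K₂ v y ≡ true → M (rowB v t , y) ≡ true
    rowB∈M v t = covering-true multicut (K₂ v) (cliques₂ v) (proj₁ (proj₂ (rowsB v)) t)

    a : V₂ → V₂ → Carrier
    a v = proj₁ (coding₂ v)

    outside-enumeration = Counting.enumerate-false n₂ (fS₂ ∘ V₂.to)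

    #outside : ℕ
    #outside = sumℕ n₂ (Counting.indicator ∘ not ∘ fS₂ ∘ V₂.to)

    outside : Fin #outside → V₂
    outside = V₂.to ∘ proj₁ outside-enumeration

    outside-injective : ∀ {j j'} → outside j ≡ outside j' → j ≡ j'
    outside-injective = proj₂ (proj₂ outside-enumeration) ∘ from-injective (↔-sym (Instance.vertices N₂))

    a·L≡0 : ∀ j m → a (outside j) Code₂.·L m ≡ 0#
    a·L≡0 j m = decidable-stable (a (outside j) Code₂.·L m ≟ 0#) λ a·L≢0 →
      case trans (sym (V₂.fS⇒fSall (proj₁ m) (outside j) (proj₂ (proj₂ (proj₂ (coding₂ (outside j)))) m a·L≢0)))
                 (proj₁ (proj₂ outside-enumeration) j) of λ ()

    open BlockIndex {n₁} {ρ₂} {#outside} {ρ₁}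

    -- n₁ρ₂ + |V₂ ∖ f₂(S)|ρ₁ vectors in the span of the rows of M in L, to be shown independent
    wA : Fin n₁ → Fin ρ₂ → MsgP → Carrier
    wA x t = prodL (V₁.to x , rowA (V₁.to x) t)

    wB : Fin #outside → Fin ρ₁ → MsgP → Carrier
    wB j t m = V₂.∑V (λ y → a (outside j) y * prodL (rowB (outside j) t , y) m)

    αA : Fin n₁ → Fin ρ₂ → Fin (n₁ ℕ.* n₂) → Carrier
    αA x t s = VP.Id (VP.to s) (V₁.to x , rowA (V₁.to x) t)

    αB : Fin #outside → Fin ρ₁ → Fin (n₁ ℕ.* n₂) → Carrier
    αB j t s = ((λ u → V₁.Id u (rowB (outside j) t)) ⊗ a (outside j)) (VP.to s)

    spanA : ∀ x t m → wA x t m ≡ CodeP.combination (αA x t) (prodL ∘ VP.to) m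
    spanA x t m = sym (VP.∑V-Id* (λ p → prodL p m) (V₁.to x , rowA (V₁.to x) t))

    spanB : ∀ j t m → wB j t m ≡ CodeP.combination (αB j t) (prodL ∘ VP.to) m
    spanB j t m = sym (begin
      VP.∑V (λ p → (Id-c ⊗ a v) p * prodL p m)
        ≡⟨ ∑-remQuot n₁ n₂ (λ x y → (Id-c ⊗ a v) (V₁.to x , V₂.to y) * prodL (V₁.to x , V₂.to y) m) ⟩
      V₁.∑V (λ x → V₂.∑V (λ y → (Id-c x * a v y) * prodL (x , y) m))
        ≡⟨ V₁.∑V-cong (λ x → trans (V₂.∑V-cong (λ y → *-assoc (Id-c x) (a v y) (prodL (x , y) m))) (sym (*-distribˡ-∑ n₂ (Id-c x) _))) ⟩
      V₁.∑V (λ x → Id-c x * V₂.∑V (λ y → a v y * prodL (x , y) m))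
        ≡⟨ V₁.∑V-Id* (λ x → V₂.∑V (λ y → a v y * prodL (x , y) m)) (rowB v t) ⟩
      wB j t m
        ∎)
      where
      v = outside j
      Id-c : V₁ → Carrier
      Id-c u = V₁.Id u (rowB v t)

    spanned : CodeP.Spans (prodL ∘ VP.to) (αA ⊕ αB) (wA ⊕ wB)
    spanned = ι-elim
      (λ x t m → trans (cong (λ w → w m) (⊕-ι₁ wA wB x t))
                       (trans (spanA x t m) (CodeP.combination-cong (prodL ∘ VP.to) (λ s → cong (λ α → α s) (sym (⊕-ι₁ αA αB x t))) m)))
      (λ j t m → trans (cong (λ w → w m) (⊕-ι₂ wA wB j t))
                       (trans (spanB j t m) (CodeP.combination-cong (prodL ∘ VP.to) (λ s → cong (λ α → α s) (sym (⊕-ι₂ αA αB j t))) m)))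

    α-supp : ∀ i s → (αA ⊕ αB) i s ≢ 0# → M (VP.to s) ≡ true
    α-supp = ι-elim
      (λ x t s ≢0 → trans (cong M (VP.Id≢0⇒≡ (≢0 ∘ trans (cong (λ α → α s) (⊕-ι₁ αA αB x t)))))
                          (proj₁ (proj₂ (rowsA (V₁.to x))) t))
      (λ j t s ≢0 → let αB≢0 = ≢0 ∘ trans (cong (λ α → α s) (⊕-ι₂ αA αB j t)) in
        trans (cong (λ u → M (u , proj₂ (VP.to s))) (V₁.Id≢0⇒≡ (x*y≢0⇒x≢0 αB≢0)))
              (rowB∈M (outside j) t _ (proj₁ (proj₂ (proj₂ (coding₂ (outside j)))) _ (x*y≢0⇒y≢0 αB≢0))))

    module Vanishing (β : Fin (n₁ ℕ.* ρ₂ ℕ.+ #outside ℕ.* ρ₁) → Carrier)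
                     (β·w≡0 : ∀ m → CodeP.combination β (wA ⊕ wB) m ≡ 0#) where

      βA : Fin n₁ → Fin ρ₂ → Carrier
      βA x t = β (ι₁ x t)

      βB : Fin #outside → Fin ρ₁ → Carrier
      βB j t = β (ι₂ j t)

      ΣA : MsgP → Carrier
      ΣA m = sumF n₁ (λ x → sumF ρ₂ (λ t → βA x t * wA x t m))

      ΣB : MsgP → Carrier
      ΣB m = sumF #outside (λ j → sumF ρ₁ (λ t → βB j t * wB j t m))

      ΣA+ΣB≡0 : ∀ m → ΣA m + ΣB m ≡ 0#
      ΣA+ΣB≡0 m = trans (sym (trans (∑-ι n₁ ρ₂ #outside ρ₁ (λ i → β i * (wA ⊕ wB) i m))
        (cong₂ _+_ (∑-cong n₁ (λ x → ∑-cong ρ₂ (λ t → cong (λ w → βA x t * w m) (⊕-ι₁ wA wB x t))))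
                   (∑-cong #outside (λ j → ∑-cong ρ₁ (λ t → cong (λ w → βB j t * w m) (⊕-ι₂ wA wB j t)))))))
        (β·w≡0 m)

      -- On the columns of I ⊗ L₂ the vectors wB vanish, because aᵥ L₂ does for v ∉ f₂(S).
      wB-msg₂ : ∀ j t m u → wB j t (msg₂ m u) ≡ 0#
      wB-msg₂ j t m u = begin
        V₂.∑V (λ y → a v y * prodL (c , y) (msg₂ m u))
          ≡⟨ V₂.∑V-cong (λ y → trans (cong (a v y *_) (prodL-msg₂ (c , y) m u)) (x∙yz≈y∙xz _ _ _)) ⟩
        V₂.∑V (λ y → V₁.Id c u * (a v y * L₂ y m))
          ≡⟨ *-distribˡ-∑ n₂ (V₁.Id c u) _ ⟨
        V₁.Id c u * (a v Code₂.·L m)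
          ≡⟨ cong (V₁.Id c u *_) (a·L≡0 j m) ⟩
        V₁.Id c u * 0#
          ≡⟨ zeroʳ _ ⟩
        0#
          ∎
        where v = outside j; c = rowB v t

      ΣA-msg₂ : ∀ x m → ΣA (msg₂ m (V₁.to x)) ≡ sumF ρ₂ (λ t → βA x t * L₂ (rowA (V₁.to x) t) m)
      ΣA-msg₂ x m = begin
        ΣA (msg₂ m (V₁.to x))
          ≡⟨ ∑-cong n₁ (λ x' → ∑-cong ρ₂ (λ t → cong (βA x' t *_) (prodL-msg₂ _ m (V₁.to x)))) ⟩
        sumF n₁ (λ x' → sumF ρ₂ (λ t → βA x' t * (V₁.Id (V₁.to x') (V₁.to x) * L₂ (rowA (V₁.to x') t) m)))
          ≡⟨ ∑-single n₁ _ x (λ x' x'≢x → ∑-0 ρ₂ (λ t →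
               trans (cong (λ e → βA x' t * (e * _)) (V₁.Id-≢ (x'≢x ∘ from-injective (↔-sym (Instance.vertices N₁)))))
                     (trans (cong (βA x' t *_) (zeroˡ _)) (zeroʳ _)))) ⟩
        sumF ρ₂ (λ t → βA x t * (V₁.Id (V₁.to x) (V₁.to x) * L₂ (rowA (V₁.to x) t) m))
          ≡⟨ ∑-cong ρ₂ (λ t → cong (βA x t *_) (trans (cong (_* L₂ (rowA (V₁.to x) t) m) (V₁.Id-refl (V₁.to x))) (*-identityˡ _))) ⟩
        sumF ρ₂ (λ t → βA x t * L₂ (rowA (V₁.to x) t) m)
          ∎

      βA≡0 : ∀ x t → βA x t ≡ 0#
      βA≡0 x = proj₂ (proj₂ (rowsA (V₁.to x))) (βA x) λ m → begin
        sumF ρ₂ (λ t → βA x t * L₂ (rowA (V₁.to x) t) m)   ≡⟨ ΣA-msg₂ x m ⟨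
        ΣA (msg₂ m (V₁.to x))                               ≡⟨ +-identityʳ _ ⟨
        ΣA (msg₂ m (V₁.to x)) + 0#                          ≡⟨ cong (ΣA (msg₂ m (V₁.to x)) +_) (∑-0 #outside (λ j → ∑-0 ρ₁ (λ t →
                                                                 trans (cong (βB j t *_) (wB-msg₂ j t m (V₁.to x))) (zeroʳ _)))) ⟨
        ΣA (msg₂ m (V₁.to x)) + ΣB (msg₂ m (V₁.to x))       ≡⟨ ΣA+ΣB≡0 _ ⟩
        0#                                                  ∎

      ΣB≡0 : ∀ m → ΣB m ≡ 0#
      ΣB≡0 m = begin
        ΣB m              ≡⟨ +-identityˡ _ ⟨
        0# + ΣB m         ≡⟨ cong (_+ ΣB m) (∑-0 n₁ (λ x → ∑-0 ρ₂ (λ t → trans (cong (_* _) (βA≡0 x t)) (zeroˡ _)))) ⟨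
        ΣA m + ΣB m       ≡⟨ ΣA+ΣB≡0 m ⟩
        0#                ∎

      wB-msg₁ : ∀ j t m v → wB j t (msg₁ m v) ≡ a (outside j) v * L₁ (rowB (outside j) t) m
      wB-msg₁ j t m v = trans (V₂.∑V-cong (λ y → trans (cong (a (outside j) y *_) (prodL-msg₁ (rowB (outside j) t , y) m v))
                                                        (sym (*-assoc _ _ _))))
                              (V₂.∑V-*Id (λ y → a (outside j) y * L₁ (rowB (outside j) t) m) v)

      μ : Fin #outside → Fin n₂
      μ j = Inverse.to π₂ (outside j)

      -- Evaluating at the columns (m , outside j) of L₁ ⊗ I, every other v' with aᵥ'(v) ≠ 0 comes later in π₂,
      -- so descending induction along π₂ isolates the term of v = outside j.
      βB-step : ∀ j → (∀ {j'} → μ j Fin.< μ j' → ∀ t → βB j' t ≡ 0#) → ∀ t → βB j t ≡ 0#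
      βB-step j later≡0 = proj₂ (proj₂ (rowsB v)) (βB j) βB·L₁≡0
        where
        v = outside j

        others≡0 : ∀ m j' → j' ≢ j → sumF ρ₁ (λ t → βB j' t * wB j' t (msg₁ m v)) ≡ 0#
        others≡0 m j' j'≢j = ∑-0 ρ₁ λ t → trans (cong (βB j' t *_) (wB-msg₁ j' t m v)) (term≡0 t)
          where
          term≡0 : ∀ t → βB j' t * (a (outside j') v * L₁ (rowB (outside j') t) m) ≡ 0#
          term≡0 t with a (outside j') v ≟ 0#
          ... | yes a≡0 = trans (cong (λ e → βB j' t * (e * _)) a≡0) (trans (cong (βB j' t *_) (zeroˡ _)) (zeroʳ _))
          ... | no a≢0 with K₂⊆Nbh (outside j') v (proj₁ (proj₂ (proj₂ (coding₂ (outside j')))) v a≢0)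
          ...   | inj₁ v≡v' = ⊥-elim (j'≢j (outside-injective (sym v≡v')))
          ...   | inj₂ (μj<μj' , _) = trans (cong (_* _) (later≡0 μj<μj' t)) (zeroˡ _)

        βB·L₁≡0 : ∀ m → sumF ρ₁ (λ t → βB j t * L₁ (rowB v t) m) ≡ 0#
        βB·L₁≡0 m = x≢0∧x*y≡0⇒y≡0 (proj₁ (proj₂ (coding₂ v))) (begin
          a v v * sumF ρ₁ (λ t → βB j t * L₁ (rowB v t) m)
            ≡⟨ *-distribˡ-∑ ρ₁ (a v v) _ ⟩
          sumF ρ₁ (λ t → a v v * (βB j t * L₁ (rowB v t) m))
            ≡⟨ ∑-cong ρ₁ (λ t → trans (x∙yz≈y∙xz _ _ _) (cong (βB j t *_) (sym (wB-msg₁ j t m v)))) ⟩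
          sumF ρ₁ (λ t → βB j t * wB j t (msg₁ m v))
            ≡⟨ ∑-single #outside (λ j' → sumF ρ₁ (λ t → βB j' t * wB j' t (msg₁ m v))) j (others≡0 m) ⟨
          ΣB (msg₁ m v)
            ≡⟨ ΣB≡0 (msg₁ m v) ⟩
          0#
            ∎)

      βB≡0 : ∀ j t → βB j t ≡ 0#
      βB≡0 = All.wfRec (On.wellFounded μ FinInd.>-wellFounded) 0ℓ (λ j → ∀ t → βB j t ≡ 0#) βB-step

      β≡0 : ∀ i → β i ≡ 0#
      β≡0 = ι-elim βA≡0 βB≡0

    rank : RankAtLeast (Codes.LᵀI F P C M) (n₁ ℕ.* ρ₂ ℕ.+ #outside ℕ.* ρ₁)
    rank = CodeP.spanned-by-rows⇒RankAtLeast M VP.to (αA ⊕ αB) (wA ⊕ wB) α-supp spanned Vanishing.β≡0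

    rate≡ : n₁ ℕ.* ρ₂ ℕ.+ n₂ ℕ.* ρ₁ ℕ.∸ ρ₁ ℕ.* Instance.card N₂ fS₂ ≡ n₁ ℕ.* ρ₂ ℕ.+ #outside ℕ.* ρ₁
    rate≡ = Counting.complement-arithmetic (n₁ ℕ.* ρ₂) ρ₁ _ #outside n₂
           (Counting.∑-indicator+∑-indicator-not n₂ (fS₂ ∘ V₂.to))

  certifiable : ∀ ρ₁ ρ₂ → Codes.Certifiable F N₁ C₁ ρ₁ → Codes.Certifiable F N₂ C₂ ρ₂ →
    Codes.Certifiable F P C (n₁ ℕ.* ρ₂ ℕ.+ n₂ ℕ.* ρ₁ ℕ.∸ ρ₁ ℕ.* Instance.card N₂ (Instance.fSall N₂))
  certifiable ρ₁ ρ₂ (certificate₁ , rank₁) (certificate₂@(K₂ , cliques₂ , K₂⊆Nbh , coding₂) , rank₂) =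
    ⊠-cliqueCertificate certificate₁ certificate₂ ,
    λ M multicut → let open Certification ρ₁ ρ₂ rank₁ rank₂ K₂ cliques₂ K₂⊆Nbh coding₂ multicut
                   in subst (RankAtLeast (Codes.LᵀI F P C M)) (sym rate≡) rank

open import Data.Nat using (_+_; _*_; _∸_)

theorem2 : (F : FiniteField) (N₁ N₂ : Instance)
  (C₁ : Codes.Code F N₁) (C₂ : Codes.Code F N₂) →
  Codes.IsLinearNetworkCode F N₁ C₁ →
  Codes.IsLinearNetworkCode F N₂ C₂ →
  Σ[ π ∈ (Instance.V (N₁ ⊠ N₂) ↔ Fin (Instance.n (N₁ ⊠ N₂))) ]
    (Codes.IsLinearNetworkCode F (N₁ ⊠ N₂) (ProductCode.prodCode F N₁ N₂ C₁ C₂ π)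
    × (∀ (p₁ p₂ : ℕ) →
         Codes.Decodable F N₁ C₁ p₁ →
         Codes.Decodable F N₂ C₂ p₂ →
         Codes.Decodable F (N₁ ⊠ N₂) (ProductCode.prodCode F N₁ N₂ C₁ C₂ π)
           (Instance.n N₁ * p₂ + Instance.n N₂ * p₁
             ∸ p₁ * Instance.card N₂ (Instance.fTall N₂)))
    × (∀ (ρ₁ ρ₂ : ℕ) →
         Codes.Certifiable F N₁ C₁ ρ₁ →
         Codes.Certifiable F N₂ C₂ ρ₂ →
         Codes.Certifiable F (N₁ ⊠ N₂) (ProductCode.prodCode F N₁ N₂ C₁ C₂ π)
           (Instance.n N₁ * ρ₂ + Instance.n N₂ * ρ₁
             ∸ ρ₁ * Instance.card N₂ (Instance.fSall N₂))))
theorem2 F N₁ N₂ C₁ C₂ coding₁ coding₂ =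
  π , isLinearNetworkCode coding₁ coding₂ , decodable , certifiable
  where open Product F N₁ N₂ C₁ C₂
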